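{- Let $k\geq 2$, $a,b\geq 1$ with $a\neq b$, and $r\geq 0$ be integers. Define for integers $i\geq 1$ \[ f(i)=\sum_{\substack{1\leq d\leq (ai+r)^{1/k}\\ \gcd(a-b,d^k)\mid bi+r}}\frac{\mu(d)\gcd(a-b,d^k)}{d^k}, \] where $\mu$ is the Möbius function. Then for every $N\geq 1$, \[ \sum_{1\leq i\leq N}f(i)=\theta_k(a,b,r)N+O(N^{1/k}), \] where \[ \theta_k(a,b,r)=\prod_{\substack{p \text{ prime}\\ \gcd(a,b,p^k)\mid r}}\Big(1-\frac{\gcd(a,b,p^k)}{p^k}\Big), \] and the implied constant depends only on $k,a,b,r$. -}

module Defs where

open import Data.Nat as ℕ using (ℕ; zero; suc; _≤?_; _^_; NonZero)
open import Data.Nat.Properties using (m^n≢0)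
open import Data.Nat.Divisibility using (_∣_; _∣?_)
open import Data.Nat.GCD using (gcd)
open import Data.Nat.Primality using (Prime; prime?)
open import Data.Integer as ℤ using (ℤ; +_)
open import Data.Rational as ℚ using (ℚ; 0ℚ; 1ℚ; _/_)
open import Data.List using (List; []; _∷_; upTo; foldr; map; length; filter)
open import Relation.Nullary using (Dec; yes; no; does)
open import Relation.Nullary.Decidable using (_×-dec_; ¬?)
open import Data.Product using (_,_)
open import Data.Bool using (Bool; true; false; if_then_else_)

sumℚ : List ℚ → ℚ
sumℚ = foldr ℚ._+_ 0ℚ

prodℚ : List ℚ → ℚ
prodℚ = foldr ℚ._*_ 1ℚ

_^ℚ_ : ℚ → ℕ → ℚ
x ^ℚ zero = 1ℚ
x ^ℚ suc n = x ℚ.* (x ^ℚ n)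

absDiff : ℕ → ℕ → ℕ
absDiff a b = ℤ.∣ + a ℤ.- + b ∣

squarefree? : ℕ → Bool
squarefree? d = foldr (λ m acc → if does (m ℕ.* m ∣? d) then false else acc) true
                      (map (λ j → suc (suc j)) (upTo d))

primeDivisors : ℕ → List ℕ
primeDivisors d = filter (λ p → prime? p ×-dec (p ∣? d)) (upTo (suc d))

μ : ℕ → ℤ
μ d = if squarefree? d then (ℤ.-1ℤ ℤ.^ length (primeDivisors d)) else ℤ.0ℤ

-- the summand of f(i) for d = suc m (d ≥ 1):
-- included iff d^k ≤ a i + r (i.e. d ≤ (a i + r)^{1/k}) and gcd(a-b, d^k) ∣ b i + r
term : (k a b r i m : ℕ) → ℚ
term k a b r i m with (suc m ^ k ≤? a ℕ.* i ℕ.+ r) ×-dec (gcd (absDiff a b) (suc m ^ k) ∣? b ℕ.* i ℕ.+ r)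
... | yes _ = _/_ (μ (suc m) ℤ.* + gcd (absDiff a b) (suc m ^ k))
              (suc m ^ k) {{m^n≢0 (suc m) k}}
... | no _ = 0ℚ

-- f(i) = ∑_{1 ≤ d ≤ (ai+r)^{1/k}, gcd(a-b,d^k) ∣ bi+r} μ(d) gcd(a-b,d^k) / d^k
-- (every such d satisfies d ≤ d^k ≤ ai+r, so d ranges over 1..ai+r)
f : (k a b r i : ℕ) → ℚ
f k a b r i = sumℚ (map (term k a b r i) (upTo (a ℕ.* i ℕ.+ r)))

S : (k a b r N : ℕ) → ℚ
S k a b r N = sumℚ (map (λ j → f k a b r (suc j)) (upTo N))

factor : (k a b r p : ℕ) → ℚ
factor k a b r p with prime? p ×-dec (gcd (gcd a b) (p ^ k) ∣? r)
... | yes (pp , _) = 1ℚ ℚ.- _/_ (+ gcd (gcd a b) (p ^ k)) (p ^ k) {{m^n≢0 p k {{pnz pp}}}}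
  where
  pnz : ∀ {p} → Prime p → NonZero p
  pnz {suc _} _ = _
... | no _ = 1ℚ

θpartial : (k a b r P : ℕ) → ℚ
θpartial k a b r P = prodℚ (map (factor k a b r) (upTo (suc P)))

-- Exchanging the two summations, S(N) = ∑_{d ≤ aN+r} c_d μ(d) g_d / dᵏ, where
-- g_d = gcd(a − b, dᵏ) and c_d counts the i ≤ N with dᵏ ≤ ai + r and g_d ∣ bi + r.
-- The congruence g_d ∣ bi + r is solvable iff gcd(b, g_d) = gcd(a, b, dᵏ) divides r, and
-- then it has N gcd(a, b, dᵏ) / g_d + O(1) solutions i ≤ N.  So c_d μ(d) g_d / dᵏ is
-- N w(d) up to O(|a − b| (1 + β_d) / dᵏ), where w(d) = μ(d) gcd(a, b, dᵏ) / dᵏ if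
-- gcd(a, b, dᵏ) ∣ r and 0 otherwise, and β_d ≤ min(dᵏ, N) counts the i ≤ N with
-- ai + r < dᵏ.  Splitting at Y = ⌊N^{1/k}⌋, the d ≤ Y contribute O(Y) and, as
-- N < (Y + 1)ᵏ, the d > Y contribute O((Y + 1)² ∑_{d > Y} 1/d²) = O(Y).
-- On the other side w is multiplicative and vanishes off the square-free numbers, so its
-- sum over the divisors of the product of the primes ≤ P is the partial Euler product;
-- for P ≥ aN + r the divisors beyond aN + r contribute O(1/N) since |w(d)| ≤ a / d².
-- Altogether |S(N) − θ_P N| ≤ K N^{1/k}; the theorem follows by taking k-th powers.

module Submission where

open import Data.Nat as ℕ hiding (_/_; _%_)
open import Data.Nat.Properties
open import Data.Nat.Divisibility
open import Data.Nat.DivMod using (m≡m%n+[m/n]*n; m%n<n; m/n*n≡m)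
open import Data.Nat.GCD
open import Data.Nat.Coprimality as Coprimality using (Coprime)
open import Data.Nat.Primality
open import Data.Integer as ℤ using (ℤ; +_)
import Data.Integer.Properties as ℤₚ
open import Data.Rational as ℚ using (ℚ; _/_; 0ℚ; 1ℚ; Positive)
import Data.Rational.Properties as ℚₚ
import Data.Rational.Unnormalised as ℚᵘ
import Data.Rational.Unnormalised.Properties as ℚᵘₚ
import Data.Rational.Solver as ℚ-Solver
import Data.Nat.Tactic.RingSolver as ℕ-Ring
import Data.Integer.Tactic.RingSolver as ℤ-Ring
open import Data.List using (List; []; _∷_; map; applyUpTo; upTo; filter; length; _++_; foldr)
open import Data.Bool using (Bool; true; false; if_then_else_)
import Data.List.Properties as List
open import Data.Product using (_×_; _,_; proj₁; proj₂; ∃)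
open import Data.Sum using (_⊎_; inj₁; inj₂; [_,_])
open import Function using (_∘_; id)
open import Relation.Binary.PropositionalEquality hiding ([_])
open import Relation.Nullary using (Dec; yes; no; ¬_; contradiction; does)
open import Relation.Nullary.Decidable using (_×-dec_; ¬?; dec-true; dec-false)
open import Relation.Unary using (Decidable)
open import Data.Nat.Primality.Factorisation using (factorise)
open import Data.Nat.ListAction using (product)
open import Data.List.Relation.Unary.All using (_∷_)
open import Algebra.Bundles using (CommutativeMonoid)
import Algebra.Properties.CommutativeSemigroup as CommutativeSemigroupProperties
open import Defs

toℚᵘ-/ : ∀ z n .{{_ : NonZero n}} → ℚ.toℚᵘ (z / n) ℚᵘ.≃ ℚᵘ.mkℚᵘ z (pred n)
toℚᵘ-/ z (suc n) = ℚₚ.toℚᵘ-fromℚᵘ (ℚᵘ.mkℚᵘ z n)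

/-cross-≡ : ∀ z w m n .{{_ : NonZero m}} .{{_ : NonZero n}} →
            z ℤ.* + n ≡ w ℤ.* + m → z / m ≡ w / n
/-cross-≡ z w m@(suc _) n@(suc _) eq = ℚₚ.toℚᵘ-injective
  (ℚᵘₚ.≃-trans (toℚᵘ-/ z m) (ℚᵘₚ.≃-trans (ℚᵘ.*≡* eq) (ℚᵘₚ.≃-sym (toℚᵘ-/ w n))))

/-cross-≤ : ∀ z w m n .{{_ : NonZero m}} .{{_ : NonZero n}} →
            z ℤ.* + n ℤ.≤ w ℤ.* + m → z / m ℚ.≤ w / n
/-cross-≤ z w m@(suc _) n@(suc _) le = ℚₚ.toℚᵘ-cancel-≤ (ℚᵘₚ.≤-trans
  (ℚᵘₚ.≤-reflexive (toℚᵘ-/ z m)) (ℚᵘₚ.≤-trans (ℚᵘ.*≤* le) (ℚᵘₚ.≤-reflexive (ℚᵘₚ.≃-sym (toℚᵘ-/ w n)))))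

/-+ : ∀ x y m n .{{_ : NonZero m}} .{{_ : NonZero n}} →
      x / m ℚ.+ y / n ≡ _/_ (x ℤ.* + n ℤ.+ y ℤ.* + m) (m * n) {{m*n≢0 m n}}
/-+ x y m@(suc _) n@(suc _) = ℚₚ.toℚᵘ-injective (ℚᵘₚ.≃-trans (ℚₚ.toℚᵘ-homo-+ (x / m) (y / n))
  (ℚᵘₚ.≃-trans (ℚᵘₚ.+-cong (toℚᵘ-/ x m) (toℚᵘ-/ y n)) (ℚᵘₚ.≃-sym (toℚᵘ-/ _ (m * n)))))

/-* : ∀ x y m n .{{_ : NonZero m}} .{{_ : NonZero n}} →
      (x / m) ℚ.* (y / n) ≡ _/_ (x ℤ.* y) (m * n) {{m*n≢0 m n}}
/-* x y m@(suc _) n@(suc _) = ℚₚ.toℚᵘ-injective (ℚᵘₚ.≃-trans (ℚₚ.toℚᵘ-homo-* (x / m) (y / n))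
  (ℚᵘₚ.≃-trans (ℚᵘₚ.*-cong (toℚᵘ-/ x m) (toℚᵘ-/ y n)) (ℚᵘₚ.≃-sym (toℚᵘ-/ _ (m * n)))))

neg-/ : ∀ x m .{{_ : NonZero m}} → ℚ.- (x / m) ≡ ℤ.- x / m
neg-/ x m@(suc _) = ℚₚ.toℚᵘ-injective (ℚᵘₚ.≃-trans (ℚₚ.toℚᵘ-homo‿- (x / m))
  (ℚᵘₚ.≃-trans (ℚᵘₚ.-‿cong (toℚᵘ-/ x m)) (ℚᵘₚ.≃-sym (toℚᵘ-/ _ m))))

∣/∣ : ∀ x m .{{_ : NonZero m}} → ℚ.∣ x / m ∣ ≡ + ℤ.∣ x ∣ / m
∣/∣ x m@(suc _) = ℚₚ.toℚᵘ-injective (ℚᵘₚ.≃-trans (ℚₚ.toℚᵘ-homo-∣-∣ (x / m))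
  (ℚᵘₚ.≃-trans (ℚᵘₚ.∣-∣-cong (toℚᵘ-/ x m)) (ℚᵘₚ.≃-sym (toℚᵘ-/ _ m))))

/-sub : ∀ z w n .{{_ : NonZero n}} → z / n ℚ.- w / n ≡ (z ℤ.- w) / n
/-sub z w n = begin
  z / n ℚ.+ ℚ.- (w / n) ≡⟨ cong (z / n ℚ.+_) (neg-/ w n) ⟩
  z / n ℚ.+ ℤ.- w / n   ≡⟨ /-+ z (ℤ.- w) n n ⟩
  _/_ (z ℤ.* + n ℤ.+ ℤ.- w ℤ.* + n) (n * n) {{m*n≢0 n n}}
    ≡⟨ /-cross-≡ (z ℤ.* + n ℤ.+ ℤ.- w ℤ.* + n) (z ℤ.- w) (n * n) n {{m*n≢0 n n}} eq ⟩
  (z ℤ.- w) / n         ∎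
  where
  open ≡-Reasoning
  eq : (z ℤ.* + n ℤ.+ ℤ.- w ℤ.* + n) ℤ.* + n ≡ (z ℤ.- w) ℤ.* + (n * n)
  eq = trans (distrib z w (+ n)) (cong ((z ℤ.- w) ℤ.*_) (sym (ℤₚ.pos-* n n)))
    where
    distrib : ∀ z w m → (z ℤ.* m ℤ.+ ℤ.- w ℤ.* m) ℤ.* m ≡ (z ℤ.- w) ℤ.* (m ℤ.* m)
    distrib = ℤ-Ring.solve-∀

/-cross-≤ℕ : ∀ p q m n .{{_ : NonZero m}} .{{_ : NonZero n}} →
             p * n ≤ q * m → + p / m ℚ.≤ + q / n
/-cross-≤ℕ p q m n le = /-cross-≤ (+ p) (+ q) m n (subst₂ ℤ._≤_ (ℤₚ.pos-* p n) (ℤₚ.pos-* q m) (ℤ.+≤+ le))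

/-mono-≤ : ∀ {p q} n .{{_ : NonZero n}} → p ≤ q → + p / n ℚ.≤ + q / n
/-mono-≤ {p} {q} n p≤q = /-cross-≤ℕ p q n n (*-monoˡ-≤ n p≤q)

-- An opaque copy of _/_: when a fraction with symbolic numerator or denominator
-- has to be compared, Agda unfolds its gcd-normalisation and runs out of memory.

opaque
  frac : ℤ → (n : ℕ) → .{{NonZero n}} → ℚ
  frac z n = z / n

opaque
  unfolding frac
  frac≡/ : ∀ z n .{{_ : NonZero n}} → frac z n ≡ z / n
  frac≡/ z n = refl

fromℕ : ℕ → ℚ
fromℕ n = + n / 1

fromℕ-+ : ∀ m n → fromℕ (m + n) ≡ fromℕ m ℚ.+ fromℕ n
fromℕ-+ m n = trans (/-cross-≡ (+ (m + n)) (+ m ℤ.* + 1 ℤ.+ + n ℤ.* + 1) 1 1 (cong (ℤ._* + 1) eq))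
                    (sym (/-+ (+ m) (+ n) 1 1))
  where
  eq : + (m + n) ≡ + m ℤ.* + 1 ℤ.+ + n ℤ.* + 1
  eq = trans (ℤₚ.pos-+ m n) (sym (cong₂ ℤ._+_ (ℤₚ.*-identityʳ (+ m)) (ℤₚ.*-identityʳ (+ n))))

fromℕ-* : ∀ m n → fromℕ (m * n) ≡ fromℕ m ℚ.* fromℕ n
fromℕ-* m n = trans (cong (_/ 1) (ℤₚ.pos-* m n)) (sym (/-* (+ m) (+ n) 1 1))

fromℕ-^ : ∀ n k → fromℕ (n ^ k) ≡ fromℕ n ^ℚ k
fromℕ-^ n zero    = refl
fromℕ-^ n (suc k) = trans (fromℕ-* n (n ^ k)) (cong (fromℕ n ℚ.*_) (fromℕ-^ n k))

fromℕ-mono-≤ : ∀ {m n} → m ≤ n → fromℕ m ℚ.≤ fromℕ n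
fromℕ-mono-≤ = /-mono-≤ 1

fromℕ-nonNeg : ∀ n → ℚ.NonNegative (fromℕ n)
fromℕ-nonNeg n = ℚₚ.normalize-nonNeg n 1

fromℕ-*-/ : ∀ m z n .{{_ : NonZero n}} → fromℕ m ℚ.* (z / n) ≡ (+ m ℤ.* z) / n
fromℕ-*-/ m z n = trans (/-* (+ m) z 1 n) (/-cross-≡ (+ m ℤ.* z) (+ m ℤ.* z) (1 * n) n {{m*n≢0 1 n}}
  (cong (λ d → + m ℤ.* z ℤ.* + d) (sym (*-identityˡ n))))

fromℕ-*-/ℕ : ∀ m n d .{{_ : NonZero d}} → fromℕ m ℚ.* (+ n / d) ≡ + (m * n) / d
fromℕ-*-/ℕ m n d = trans (fromℕ-*-/ m (+ n) d) (cong (_/ d) (sym (ℤₚ.pos-* m n)))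

^ℚ-mono-≤ : ∀ {x y} k → 0ℚ ℚ.≤ x → x ℚ.≤ y → x ^ℚ k ℚ.≤ y ^ℚ k
^ℚ-mono-≤ zero    _   _   = ℚₚ.≤-refl
^ℚ-mono-≤ {x} {y} (suc k) 0≤x x≤y = ℚₚ.≤-trans
  (ℚₚ.*-monoʳ-≤-nonNeg (x ^ℚ k) {{ℚ.nonNegative (^ℚ-nonNeg k)}} x≤y)
  (ℚₚ.*-monoˡ-≤-nonNeg y {{ℚ.nonNegative (ℚₚ.≤-trans 0≤x x≤y)}} (^ℚ-mono-≤ k 0≤x x≤y))
  where
  ^ℚ-nonNeg : ∀ k → 0ℚ ℚ.≤ x ^ℚ k
  ^ℚ-nonNeg zero    = ℚₚ.<⇒≤ (ℚₚ.positive⁻¹ 1ℚ)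
  ^ℚ-nonNeg (suc k) = ℚₚ.nonNegative⁻¹ _ {{ℚₚ.nonNeg*nonNeg⇒nonNeg x {{ℚ.nonNegative 0≤x}} _ {{ℚ.nonNegative (^ℚ-nonNeg k)}}}}

∑ : ℕ → (ℕ → ℚ) → ℚ
∑ zero    F = 0ℚ
∑ (suc n) F = F 0 ℚ.+ ∑ n (F ∘ suc)

syntax ∑ n (λ i → e) = ∑[ i < n ] e

sumℚ-upTo : ∀ (F : ℕ → ℚ) n → sumℚ (map F (upTo n)) ≡ ∑ n F
sumℚ-upTo F n = go F id n
  where
  go : ∀ F g n → sumℚ (map F (applyUpTo g n)) ≡ ∑ n (F ∘ g)
  go F g zero    = refl
  go F g (suc n) = cong (F (g 0) ℚ.+_) (go F (g ∘ suc) n)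

∑-snoc : ∀ n F → ∑ (suc n) F ≡ ∑ n F ℚ.+ F n
∑-snoc zero    F = trans (ℚₚ.+-identityʳ (F 0)) (sym (ℚₚ.+-identityˡ (F 0)))
∑-snoc (suc n) F = trans (cong (F 0 ℚ.+_) (∑-snoc n (F ∘ suc))) (sym (ℚₚ.+-assoc (F 0) _ _))

∑-cong : ∀ n {F G} → (∀ i → i < n → F i ≡ G i) → ∑ n F ≡ ∑ n G
∑-cong zero    eq = refl
∑-cong (suc n) eq = cong₂ ℚ._+_ (eq 0 z<s) (∑-cong n (λ i i<n → eq (suc i) (s<s i<n)))

∑-+ : ∀ n F G → ∑[ i < n ] (F i ℚ.+ G i) ≡ ∑ n F ℚ.+ ∑ n G
∑-+ zero    F G = refl
∑-+ (suc n) F G = trans (cong (F 0 ℚ.+ G 0 ℚ.+_) (∑-+ n (F ∘ suc) (G ∘ suc)))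
                        (ℚ+.interchange (F 0) (G 0) (∑ n (F ∘ suc)) (∑ n (G ∘ suc)))
  where module ℚ+ = CommutativeSemigroupProperties (CommutativeMonoid.commutativeSemigroup ℚₚ.+-0-commutativeMonoid)

∑-*ˡ : ∀ n c F → ∑[ i < n ] (c ℚ.* F i) ≡ c ℚ.* ∑ n F
∑-*ˡ zero    c F = sym (ℚₚ.*-zeroʳ c)
∑-*ˡ (suc n) c F = trans (cong (c ℚ.* F 0 ℚ.+_) (∑-*ˡ n c (F ∘ suc))) (sym (ℚₚ.*-distribˡ-+ c (F 0) _))

∑-neg : ∀ n F → ∑[ i < n ] (ℚ.- F i) ≡ ℚ.- ∑ n F
∑-neg zero    F = refl
∑-neg (suc n) F = trans (cong (ℚ.- F 0 ℚ.+_) (∑-neg n (F ∘ suc))) (sym (ℚₚ.neg-distrib-+ (F 0) _))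

∑-sub : ∀ n F G → ∑[ i < n ] (F i ℚ.- G i) ≡ ∑ n F ℚ.- ∑ n G
∑-sub n F G = trans (∑-+ n F (λ i → ℚ.- G i)) (cong (∑ n F ℚ.+_) (∑-neg n G))

∑-const : ∀ n c → ∑[ i < n ] c ≡ fromℕ n ℚ.* c
∑-const zero    c = sym (ℚₚ.*-zeroˡ c)
∑-const (suc n) c = begin
  c ℚ.+ ∑[ i < n ] c          ≡⟨ cong (c ℚ.+_) (∑-const n c) ⟩
  c ℚ.+ fromℕ n ℚ.* c         ≡⟨ cong (ℚ._+ fromℕ n ℚ.* c) (sym (ℚₚ.*-identityˡ c)) ⟩
  1ℚ ℚ.* c ℚ.+ fromℕ n ℚ.* c  ≡⟨ sym (ℚₚ.*-distribʳ-+ c 1ℚ (fromℕ n)) ⟩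
  (1ℚ ℚ.+ fromℕ n) ℚ.* c      ≡⟨ cong (ℚ._* c) (sym (fromℕ-+ 1 n)) ⟩
  fromℕ (suc n) ℚ.* c         ∎
  where open ≡-Reasoning

∑-zero : ∀ n {F} → (∀ i → i < n → F i ≡ 0ℚ) → ∑ n F ≡ 0ℚ
∑-zero n eq = trans (∑-cong n eq) (trans (∑-const n 0ℚ) (ℚₚ.*-zeroʳ (fromℕ n)))

∑-mono-≤ : ∀ n {F G} → (∀ i → i < n → F i ℚ.≤ G i) → ∑ n F ℚ.≤ ∑ n G
∑-mono-≤ zero    le = ℚₚ.≤-refl
∑-mono-≤ (suc n) le = ℚₚ.+-mono-≤ (le 0 z<s) (∑-mono-≤ n (λ i i<n → le (suc i) (s<s i<n)))

∣∑∣≤∑∣∣ : ∀ n F → ℚ.∣ ∑ n F ∣ ℚ.≤ ∑[ i < n ] ℚ.∣ F i ∣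
∣∑∣≤∑∣∣ zero    F = ℚₚ.≤-refl
∣∑∣≤∑∣∣ (suc n) F = ℚₚ.≤-trans (ℚₚ.∣p+q∣≤∣p∣+∣q∣ (F 0) _) (ℚₚ.+-monoʳ-≤ ℚ.∣ F 0 ∣ (∣∑∣≤∑∣∣ n (F ∘ suc)))

∑-split : ∀ m n F → ∑ (m + n) F ≡ ∑ m F ℚ.+ ∑[ i < n ] F (m + i)
∑-split zero    n F = sym (ℚₚ.+-identityˡ _)
∑-split (suc m) n F = trans (cong (F 0 ℚ.+_) (∑-split m n (F ∘ suc))) (sym (ℚₚ.+-assoc (F 0) _ _))

∑-swap : ∀ n m (F : ℕ → ℕ → ℚ) → ∑[ i < n ] ∑[ j < m ] F i j ≡ ∑[ j < m ] ∑[ i < n ] F i j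
∑-swap zero    m F = sym (∑-zero m (λ _ _ → refl))
∑-swap (suc n) m F = trans (cong (∑ m (F 0) ℚ.+_) (∑-swap n m (F ∘ suc))) (sym (∑-+ m (F 0) _))

count : ∀ {P : ℕ → Set} → Decidable P → ℕ → ℕ
count P? zero    = 0
count P? (suc n) with P? n
... | yes _ = suc (count P? n)
... | no  _ = count P? n

when : ∀ {A : Set} → Dec A → ℚ → ℚ
when (yes _) v = v
when (no  _) v = 0ℚ

when-yes : ∀ {A : Set} (A? : Dec A) v → A → when A? v ≡ v
when-yes (yes _) v _ = refl
when-yes (no ¬a) v a = contradiction a ¬a

when-no : ∀ {A : Set} (A? : Dec A) v → ¬ A → when A? v ≡ 0ℚ
when-no (yes a) v ¬a = contradiction a ¬a
when-no (no  _) v _  = refl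

∣when∣≤∣∣ : ∀ {A : Set} (A? : Dec A) v → ℚ.∣ when A? v ∣ ℚ.≤ ℚ.∣ v ∣
∣when∣≤∣∣ (yes _) v = ℚₚ.≤-refl
∣when∣≤∣∣ (no  _) v = ℚₚ.0≤∣p∣ v

∑-when : ∀ {P : ℕ → Set} (P? : Decidable P) v n → ∑[ j < n ] when (P? j) v ≡ fromℕ (count P? n) ℚ.* v
∑-when P? v zero    = sym (ℚₚ.*-zeroˡ v)
∑-when P? v (suc n) with P? n | ∑-snoc n (λ j → when (P? j) v)
... | yes _ | eq = begin
  _                                   ≡⟨ eq ⟩
  ∑[ j < n ] when (P? j) v ℚ.+ v       ≡⟨ cong (ℚ._+ v) (∑-when P? v n) ⟩
  fromℕ (count P? n) ℚ.* v ℚ.+ v       ≡⟨ ℚₚ.+-comm _ v ⟩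
  v ℚ.+ fromℕ (count P? n) ℚ.* v       ≡⟨ cong (v ℚ.+_) (sym (∑-const (count P? n) v)) ⟩
  ∑[ i < suc (count P? n) ] v          ≡⟨ ∑-const (suc (count P? n)) v ⟩
  fromℕ (suc (count P? n)) ℚ.* v       ∎
  where open ≡-Reasoning
... | no _  | eq = trans eq (trans (ℚₚ.+-identityʳ _) (∑-when P? v n))

module _ {P : ℕ → Set} (P? : Decidable P) where

  count-≤ : ∀ n → count P? n ≤ n
  count-≤ zero = z≤n
  count-≤ (suc n) with P? n
  ... | yes _ = s≤s (count-≤ n)
  ... | no  _ = m≤n⇒m≤1+n (count-≤ n)

  count-zero : ∀ n → (∀ j → j < n → ¬ P j) → count P? n ≡ 0
  count-zero zero    none = refl
  count-zero (suc n) none with P? n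
  ... | yes p = contradiction p (none n ≤-refl)
  ... | no  _ = count-zero n (λ j j<n → none j (m≤n⇒m≤1+n j<n))

  count-bounded : ∀ n t → (∀ j → j < n → P j → j < t) → count P? n ≤ t
  count-bounded zero    t _ = z≤n
  count-bounded (suc n) t bd with P? n
  ... | yes p = ≤-trans (s≤s (count-≤ n)) (bd n ≤-refl p)
  ... | no  _ = count-bounded n t (λ j j<n → bd j (m≤n⇒m≤1+n j<n))

  count-unique : ∀ n j → j < n → P j → (∀ i → i < n → P i → i ≡ j) → count P? n ≡ 1
  count-unique zero    j () _ _
  count-unique (suc n) j j<1+n p uniq with P? n
  ... | yes pn = cong suc (count-zero n (λ i i<n pi →
                   <-irrefl (trans (uniq i (m≤n⇒m≤1+n i<n) pi) (sym (uniq n ≤-refl pn))) i<n))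
  ... | no ¬pn = count-unique n j (≤∧≢⇒< (≤-pred j<1+n) (λ { refl → ¬pn p })) p
                   (λ i i<n → uniq i (m≤n⇒m≤1+n i<n))

  count-+ : ∀ m n → count P? (m + n) ≡ count P? m + count (λ j → P? (m + j)) n
  count-+ m zero = trans (cong (count P?) (+-identityʳ m)) (sym (+-identityʳ _))
  count-+ m (suc n) rewrite +-suc m n with P? (m + n)
  ... | yes _ = trans (cong suc (count-+ m n)) (sym (+-suc _ _))
  ... | no  _ = count-+ m n

  count-mono-≤ : ∀ {m n} → m ≤ n → count P? m ≤ count P? n
  count-mono-≤ {m} {n} m≤n = subst (λ x → count P? m ≤ count P? x) (m+[n∸m]≡n m≤n)
    (subst (count P? m ≤_) (sym (count-+ m (n ∸ m))) (m≤m+n _ _))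

module _ {P Q : ℕ → Set} (P? : Decidable P) (Q? : Decidable Q) where

  count-⊆ : ∀ n → (∀ j → j < n → P j → Q j) → count P? n ≤ count Q? n
  count-⊆ zero    _ = z≤n
  count-⊆ (suc n) P⇒Q with P? n | Q? n
  ... | yes p | yes _ = s≤s (count-⊆ n (λ j j<n → P⇒Q j (m≤n⇒m≤1+n j<n)))
  ... | yes p | no ¬q = contradiction (P⇒Q n ≤-refl p) ¬q
  ... | no _  | yes _ = m≤n⇒m≤1+n (count-⊆ n (λ j j<n → P⇒Q j (m≤n⇒m≤1+n j<n)))
  ... | no _  | no _  = count-⊆ n (λ j j<n → P⇒Q j (m≤n⇒m≤1+n j<n))

  count-split : ∀ n → count Q? n ≡ count (λ j → P? j ×-dec Q? j) n + count (λ j → ¬? (P? j) ×-dec Q? j) n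
  count-split zero = refl
  count-split (suc n) with P? n | Q? n
  ... | yes _ | yes _ = cong suc (count-split n)
  ... | yes _ | no _  = count-split n
  ... | no _  | yes _ = trans (cong suc (count-split n)) (sym (+-suc _ _))
  ... | no _  | no _  = count-split n

count-cong : ∀ {P Q : ℕ → Set} (P? : Decidable P) (Q? : Decidable Q) n →
             (∀ j → j < n → (P j → Q j) × (Q j → P j)) → count P? n ≡ count Q? n
count-cong P? Q? n P⇔Q = ≤-antisym (count-⊆ P? Q? n (λ j j<n → proj₁ (P⇔Q j j<n)))
                                   (count-⊆ Q? P? n (λ j j<n → proj₂ (P⇔Q j j<n)))

-- Counting solutions of a linear congruence

m≡[m/n]*n+m%n : ∀ m n .{{_ : NonZero n}} → m ≡ m ℕ./ n * n + m ℕ.% n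
m≡[m/n]*n+m%n m n = trans (m≡m%n+[m/n]*n m n) (+-comm (m ℕ.% n) _)

module _ {P : ℕ → Set} (P? : Decidable P) (h : ℕ) .{{_ : NonZero h}}
         (periodic : ∀ j → (P (h + j) → P j) × (P j → P (h + j))) (once : count P? h ≡ 1) where

  count-periodic : ∀ q t → count P? (q * h + t) ≡ q + count P? t
  count-periodic zero    t = refl
  count-periodic (suc q) t = begin
    count P? (h + q * h + t)                            ≡⟨ cong (count P?) (+-assoc h (q * h) t) ⟩
    count P? (h + (q * h + t))                          ≡⟨ count-+ P? h (q * h + t) ⟩
    count P? h + count (λ j → P? (h + j)) (q * h + t)   ≡⟨ cong₂ _+_ once (count-cong (λ j → P? (h + j)) P? (q * h + t) (λ j _ → periodic j)) ⟩
    suc (count P? (q * h + t))                          ≡⟨ cong suc (count-periodic q t) ⟩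
    suc q + count P? t                                  ∎
    where open ≡-Reasoning

  count-periodic-bounds : ∀ N → count P? N * h ≤ N + h × N ≤ count P? N * h + h
  count-periodic-bounds N = subst (λ N → count P? N * h ≤ N + h × N ≤ count P? N * h + h) (sym N≡qh+t)
                                  (upper , lower)
    where
    q = N ℕ./ h
    t = N ℕ.% h
    N≡qh+t : N ≡ q * h + t
    N≡qh+t = m≡[m/n]*n+m%n N h
    t≤h : t ≤ h
    t≤h = <⇒≤ (m%n<n N h)
    count-t≤1 : count P? t ≤ 1
    count-t≤1 = subst (count P? t ≤_) once (count-mono-≤ P? t≤h)
    open ≤-Reasoning
    upper : count P? (q * h + t) * h ≤ q * h + t + h
    upper = begin
      count P? (q * h + t) * h   ≡⟨ cong (_* h) (count-periodic q t) ⟩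
      (q + count P? t) * h       ≡⟨ *-distribʳ-+ h q (count P? t) ⟩
      q * h + count P? t * h     ≤⟨ +-monoʳ-≤ (q * h) (*-monoˡ-≤ h count-t≤1) ⟩
      q * h + 1 * h              ≡⟨ cong (_+_ (q * h)) (*-identityˡ h) ⟩
      q * h + h                  ≤⟨ +-monoˡ-≤ h (m≤m+n (q * h) t) ⟩
      q * h + t + h              ∎
    lower : q * h + t ≤ count P? (q * h + t) * h + h
    lower = begin
      q * h + t                  ≤⟨ +-monoʳ-≤ (q * h) t≤h ⟩
      q * h + h                  ≤⟨ +-monoˡ-≤ h (*-monoˡ-≤ h (subst (q ≤_) (sym (count-periodic q t)) (m≤m+n q _))) ⟩
      count P? (q * h + t) * h + h ∎

∣<⇒≡0 : ∀ {d x} → d ∣ x → x < d → x ≡ 0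
∣<⇒≡0 (divides zero    eq) _   = eq
∣<⇒≡0 {d} (divides (suc q) refl) x<d = contradiction x<d (≤⇒≯ (m≤m+n d (q * d)))

module LinearCongruence (b c h : ℕ) .{{_ : NonZero h}} (h⊥b : Coprime h b) where

  Solves : ℕ → Set
  Solves j = h ∣ b * j + c

  solves? : Decidable Solves
  solves? j = h ∣? b * j + c

  periodic : ∀ j → (Solves (h + j) → Solves j) × (Solves j → Solves (h + j))
  periodic j = (λ s → ∣m+n∣m⇒∣n (subst (h ∣_) eq s) (∣n⇒∣m*n b ∣-refl))
             , (λ s → subst (h ∣_) (sym eq) (∣m∣n⇒∣m+n (∣n⇒∣m*n b ∣-refl) s))
    where
    eq : b * (h + j) + c ≡ b * h + (b * j + c)
    eq = trans (cong (_+ c) (*-distribˡ-+ b h j)) (+-assoc (b * h) (b * j) c)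

  unique-≤ : ∀ i j → i ≤ j → j < h → Solves i → Solves j → i ≡ j
  unique-≤ i j i≤j j<h si sj = ≤-antisym i≤j (m∸n≡0⇒m≤n j∸i≡0)
    where
    eq : b * j + c ≡ (b * i + c) + b * (j ∸ i)
    eq = begin
      b * j + c                  ≡⟨ cong (λ x → b * x + c) (sym (m+[n∸m]≡n i≤j)) ⟩
      b * (i + (j ∸ i)) + c      ≡⟨ distrib b i (j ∸ i) c ⟩
      (b * i + c) + b * (j ∸ i)  ∎
      where
      open ≡-Reasoning
      distrib : ∀ b i k c → b * (i + k) + c ≡ (b * i + c) + b * k
      distrib = ℕ-Ring.solve-∀
    j∸i≡0 : j ∸ i ≡ 0
    j∸i≡0 = ∣<⇒≡0 (Coprimality.coprime-divisor h⊥b (∣m+n∣m⇒∣n (subst (h ∣_) eq sj) si))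
                  (≤-<-trans (m∸n≤m j i) j<h)

  unique : ∀ i j → i < h → j < h → Solves i → Solves j → i ≡ j
  unique i j i<h j<h si sj with ≤-total i j
  ... | inj₁ i≤j = unique-≤ i j i≤j j<h si sj
  ... | inj₂ j≤i = sym (unique-≤ j i j≤i i<h sj si)

  negInverse : ∃ λ u → h ∣ b * u + 1
  negInverse with Coprimality.coprime-Bézout (Coprimality.sym h⊥b)
  ... | Bézout.-+ x y eq = x , divides y (trans (cong (_+ 1) (*-comm b x)) (trans (+-comm (x * b) 1) eq))
  ... | Bézout.+- x y eq = x * pred h , subst (λ H → H ∣ b * (x * pred h) + 1) (suc-pred h)
          (divides (1 + y * pred h) (shift (pred h) (subst (λ H → 1 + y * H ≡ x * b) (sym (suc-pred h)) eq)))
    where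
    shift : ∀ h′ → 1 + y * suc h′ ≡ x * b → b * (x * h′) + 1 ≡ (1 + y * h′) * suc h′
    shift h′ eq′ = begin
      b * (x * h′) + 1              ≡⟨ cong (_+ 1) (sym (*-assoc b x h′)) ⟩
      b * x * h′ + 1                ≡⟨ cong (λ z → z * h′ + 1) (trans (*-comm b x) (sym eq′)) ⟩
      (1 + y * suc h′) * h′ + 1     ≡⟨ expand y h′ ⟩
      (1 + y * h′) * suc h′         ∎
      where
      open ≡-Reasoning
      expand : ∀ y h′ → (1 + y * suc h′) * h′ + 1 ≡ (1 + y * h′) * suc h′
      expand = ℕ-Ring.solve-∀

  reduce : ∀ q t → Solves (q * h + t) → Solves t
  reduce zero    t s = s
  reduce (suc q) t s = reduce q t (proj₁ (periodic (q * h + t)) (subst Solves (+-assoc h (q * h) t) s))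

  solution : ∃ λ j → j < h × Solves j
  solution = j ℕ.% h , m%n<n j h , reduce (j ℕ./ h) (j ℕ.% h) (subst Solves (m≡[m/n]*n+m%n j h) solves-j)
    where
    u = proj₁ negInverse
    j = c * u
    solves-j : Solves j
    solves-j = subst (h ∣_) (regroup b c u) (∣n⇒∣m*n c (proj₂ negInverse))
      where
      regroup : ∀ b c u → c * (b * u + 1) ≡ b * (c * u) + c
      regroup = ℕ-Ring.solve-∀

  count-solutions-bounds : ∀ N → count solves? N * h ≤ N + h × N ≤ count solves? N * h + h
  count-solutions-bounds with solution
  ... | j , j<h , sj = count-periodic-bounds solves? h periodic
                         (count-unique solves? h j j<h sj (λ i i<h si → unique i j i<h j<h si sj))

module _ (b c g : ℕ) .{{_ : NonZero g}} where

  private instance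
    gcd≢0 : NonZero (gcd b g)
    gcd≢0 = ≢-nonZero (gcd[m,n]≢0 b g (inj₂ (≢-nonZero⁻¹ g)))

  ∣linear⇒gcd∣ : ∀ j → g ∣ b * j + c → gcd b g ∣ c
  ∣linear⇒gcd∣ j g∣ = ∣m+n∣m⇒∣n (∣-trans (gcd[m,n]∣n b g) g∣) (∣m⇒∣m*n j (gcd[m,n]∣m b g))

  -- Dividing by e = gcd b g reduces the congruence to one with coprime modulus and coefficient.
  count-linear-bounds : gcd b g ∣ c → ∀ N → let C = count (λ j → g ∣? b * j + c) N in
                        C * g ≤ N * gcd b g + g × N * gcd b g ≤ C * g + g
  count-linear-bounds e∣c N = scale (count-solutions-bounds N)
    where
    e = gcd b g
    instance
      g/e≢0 : NonZero (g ℕ./ e)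
      g/e≢0 = ≢-nonZero (n/gcd[m,n]≢0 b g)
    open LinearCongruence (b ℕ./ e) (c ℕ./ e) (g ℕ./ e) (Coprimality.sym (Coprimality.coprime-/gcd b g))
    g≡ : g ≡ g ℕ./ e * e
    g≡ = sym (m/n*n≡m (gcd[m,n]∣n b g))
    linear≡ : ∀ j → b * j + c ≡ (b ℕ./ e * j + c ℕ./ e) * e
    linear≡ j = begin
      b * j + c                           ≡⟨ cong₂ (λ u v → u * j + v) (sym (m/n*n≡m (gcd[m,n]∣m b g))) (sym (m/n*n≡m e∣c)) ⟩
      b ℕ./ e * e * j + c ℕ./ e * e       ≡⟨ distrib (b ℕ./ e) e j (c ℕ./ e) ⟩
      (b ℕ./ e * j + c ℕ./ e) * e         ∎
      where
      open ≡-Reasoning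
      distrib : ∀ b e j c → b * e * j + c * e ≡ (b * j + c) * e
      distrib = ℕ-Ring.solve-∀
    count≡ : count (λ j → g ∣? b * j + c) N ≡ count solves? N
    count≡ = count-cong _ solves? N (λ j _ →
      (λ d → *-cancelʳ-∣ e (subst₂ _∣_ g≡ (linear≡ j) d)) ,
      (λ d → subst₂ _∣_ (sym g≡) (sym (linear≡ j)) (*-monoˡ-∣ e d)))
    scale : count solves? N * (g ℕ./ e) ≤ N + g ℕ./ e × N ≤ count solves? N * (g ℕ./ e) + g ℕ./ e →
            let C = count (λ j → g ∣? b * j + c) N in C * g ≤ N * e + g × N * e ≤ C * g + g
    scale (upper , lower) = upper′ , lower′
      where
      open ≤-Reasoning
      C = count solves? N
      C*g≡ : count (λ j → g ∣? b * j + c) N * g ≡ C * (g ℕ./ e) * e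
      C*g≡ = trans (cong₂ _*_ count≡ g≡) (sym (*-assoc C (g ℕ./ e) e))
      upper′ = begin
        count (λ j → g ∣? b * j + c) N * g  ≡⟨ C*g≡ ⟩
        C * (g ℕ./ e) * e                   ≤⟨ *-monoˡ-≤ e upper ⟩
        (N + g ℕ./ e) * e                   ≡⟨ *-distribʳ-+ e N (g ℕ./ e) ⟩
        N * e + g ℕ./ e * e                 ≡⟨ cong (_+_ (N * e)) (sym g≡) ⟩
        N * e + g                           ∎
      lower′ = begin
        N * e                               ≤⟨ *-monoˡ-≤ e lower ⟩
        (C * (g ℕ./ e) + g ℕ./ e) * e       ≡⟨ *-distribʳ-+ e (C * (g ℕ./ e)) (g ℕ./ e) ⟩
        C * (g ℕ./ e) * e + g ℕ./ e * e     ≡⟨ cong₂ _+_ (sym C*g≡) (sym g≡) ⟩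
        count (λ j → g ∣? b * j + c) N * g + g ∎

prime∣prime⇒≡ : ∀ {p q} → Prime p → Prime q → p ∣ q → p ≡ q
prime∣prime⇒≡ pp pq p∣q with prime⇒irreducible pq p∣q
... | inj₁ p≡1 = contradiction p≡1 (nonTrivial⇒≢1 {{prime⇒nonTrivial pp}})
... | inj₂ p≡q = p≡q

prime∤1 : ∀ {p} → Prime p → ¬ p ∣ 1
prime∤1 pp p∣1 = nonTrivial⇒≢1 {{prime⇒nonTrivial pp}} (∣1⇒≡1 p∣1)

prime∤⇒coprime : ∀ {p n} → Prime p → ¬ p ∣ n → Coprime p n
prime∤⇒coprime pp p∤n (d∣p , d∣n) with prime⇒irreducible pp d∣p
... | inj₁ d≡1 = d≡1
... | inj₂ refl = contradiction d∣n p∤n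

prime∣^⇒∣ : ∀ {p} m k → Prime p → p ∣ m ^ k → p ∣ m
prime∣^⇒∣ m zero    pp p∣1 = contradiction p∣1 (prime∤1 pp)
prime∣^⇒∣ m (suc k) pp p∣m^k+1 = [ id , prime∣^⇒∣ m k pp ] (euclidsLemma m (m ^ k) pp p∣m^k+1)

∃prime∣ : ∀ n → 2 ≤ n → ∃ λ p → Prime p × p ∣ n
∃prime∣ 1 (s≤s ())
∃prime∣ n@(suc (suc _)) _ with factorise n
... | record { factors = []     ; isFactorisation = () }
... | record { factors = p ∷ ps ; isFactorisation = eq ; factorsPrime = pp ∷ _ } =
  p , pp , subst (p ∣_) (sym eq) (m∣m*n (product ps))

^-distribʳ-* : ∀ m n k → (m * n) ^ k ≡ m ^ k * n ^ k
^-distribʳ-* m n zero    = refl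
^-distribʳ-* m n (suc k) = trans (cong (m * n *_) (^-distribʳ-* m n k)) (interchange m n (m ^ k) (n ^ k))
  where
  interchange : ∀ m n x y → m * n * (x * y) ≡ m * x * (n * y)
  interchange = ℕ-Ring.solve-∀

coprime-*ˡ : ∀ {m n o} → Coprime m o → Coprime n o → Coprime (m * n) o
coprime-*ˡ m⊥o n⊥o {d} (d∣mn , d∣o) = n⊥o (Coprimality.coprime-divisor d⊥m d∣mn , d∣o)
  where
  d⊥m : Coprime d _
  d⊥m (e∣d , e∣m) = m⊥o (e∣m , ∣-trans e∣d d∣o)

coprime-^ˡ : ∀ {m n} k → Coprime m n → Coprime (m ^ k) n
coprime-^ˡ zero    m⊥n (d∣1 , _) = ∣1⇒≡1 d∣1
coprime-^ˡ (suc k) m⊥n = coprime-*ˡ m⊥n (coprime-^ˡ k m⊥n)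

coprime-∣ : ∀ {m n u v} → Coprime m n → u ∣ m → v ∣ n → Coprime u v
coprime-∣ m⊥n u∣m v∣n (d∣u , d∣v) = m⊥n (∣-trans d∣u u∣m , ∣-trans d∣v v∣n)

coprime⇒*∣ : ∀ {m n o} → Coprime m n → m ∣ o → n ∣ o → m * n ∣ o
coprime⇒*∣ {m} {n} m⊥n (divides q refl) n∣qm = subst (_∣ q * m) (*-comm n m)
  (*-monoˡ-∣ m (Coprimality.coprime-divisor (Coprimality.sym m⊥n) (subst (n ∣_) (*-comm q m) n∣qm)))

coprime-pow : ∀ {p n} k → Prime p → ¬ p ∣ n → Coprime (p ^ k) (n ^ k)
coprime-pow {p} {n} k pp p∤n = coprime-^ˡ k (prime∤⇒coprime pp (p∤n ∘ prime∣^⇒∣ n k pp))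

gcd-multiplicative : ∀ c m n → Coprime m n → gcd c (m * n) ≡ gcd c m * gcd c n
gcd-multiplicative c m n m⊥n = ∣-antisym D∣prod prod∣D
  where
  D = gcd c (m * n)
  D∣c = gcd[m,n]∣m c (m * n)
  prod≡ : gcd c m * gcd c n ≡ gcd (gcd (c * c) (c * n)) (gcd (m * c) (m * n))
  prod≡ = begin
    gcd c m * gcd c n                             ≡⟨ *-comm (gcd c m) (gcd c n) ⟩
    gcd c n * gcd c m                             ≡⟨ c*gcd[m,n]≡gcd[cm,cn] (gcd c n) c m ⟩
    gcd (gcd c n * c) (gcd c n * m)               ≡⟨ cong₂ gcd (trans (*-comm (gcd c n) c) (c*gcd[m,n]≡gcd[cm,cn] c c n))
                                                               (trans (*-comm (gcd c n) m) (c*gcd[m,n]≡gcd[cm,cn] m c n)) ⟩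
    gcd (gcd (c * c) (c * n)) (gcd (m * c) (m * n)) ∎
    where open ≡-Reasoning
  D∣prod : D ∣ gcd c m * gcd c n
  D∣prod = subst (D ∣_) (sym prod≡) (gcd-greatest (gcd-greatest (∣m⇒∣m*n c D∣c) (∣m⇒∣m*n n D∣c))
                                                  (gcd-greatest (∣n⇒∣m*n m D∣c) (gcd[m,n]∣n c (m * n))))
  prod∣D : gcd c m * gcd c n ∣ D
  prod∣D = gcd-greatest (coprime⇒*∣ (coprime-∣ m⊥n (gcd[m,n]∣n c m) (gcd[m,n]∣n c n)) (gcd[m,n]∣m c m) (gcd[m,n]∣m c n))
                        (*-pres-∣ (gcd[m,n]∣n c m) (gcd[m,n]∣n c n))

-- Square-free numbers and the Möbius function

SquareFree : ℕ → Set
SquareFree n = ∀ m → 2 ≤ m → ¬ (m * m ∣ n)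

SquareFree-*⁻ʳ : ∀ m n → SquareFree (m * n) → SquareFree n
SquareFree-*⁻ʳ m n sf k 2≤k kk∣n = sf k 2≤k (∣n⇒∣m*n m kk∣n)

SquareFree-* : ∀ {p n} → Prime p → ¬ p ∣ n → SquareFree n → SquareFree (p * n)
SquareFree-* {p} {n} pp p∤n sf m 2≤m mm∣pn with p ∣? m
... | yes p∣m = p∤n (*-cancelˡ-∣ p {{prime⇒nonZero pp}} (∣-trans (*-pres-∣ p∣m p∣m) mm∣pn))
... | no  p∤m = sf m 2≤m (Coprimality.coprime-divisor (Coprimality.sym (prime∤⇒coprime pp p∤mm)) mm∣pn)
  where
  p∤mm : ¬ p ∣ m * m
  p∤mm p∣mm = [ p∤m , p∤m ] (euclidsLemma m m pp p∣mm)

private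
  noneDivide : (ℕ → Bool) → List ℕ → Bool
  noneDivide D = foldr (λ m acc → if D m then false else acc) true

  noneDivide⇒ : ∀ D g n → noneDivide D (applyUpTo g n) ≡ true → ∀ j → j < n → D (g j) ≡ false
  noneDivide⇒ D g (suc n) eq j j<n with D (g 0) in D≡
  noneDivide⇒ D g (suc n) () j j<n | true
  noneDivide⇒ D g (suc n) eq zero    _         | false = D≡
  noneDivide⇒ D g (suc n) eq (suc j) (s≤s j<n) | false = noneDivide⇒ D (g ∘ suc) n eq j j<n

  ⇒noneDivide : ∀ D g n → (∀ j → j < n → D (g j) ≡ false) → noneDivide D (applyUpTo g n) ≡ true
  ⇒noneDivide D g zero    _     = refl
  ⇒noneDivide D g (suc n) none rewrite none 0 z<s = ⇒noneDivide D (g ∘ suc) n (λ j j<n → none (suc j) (s<s j<n))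

  squarefree?-unfold : ∀ d → squarefree? d ≡ noneDivide (λ m → does (m * m ∣? d)) (applyUpTo (λ j → suc (suc j)) d)
  squarefree?-unfold d = cong (noneDivide _) (List.map-applyUpTo id (λ j → suc (suc j)) d)

squarefree?⇒SquareFree : ∀ d .{{_ : NonZero d}} → squarefree? d ≡ true → SquareFree d
squarefree?⇒SquareFree d sf 1 (s≤s ())
squarefree?⇒SquareFree d sf (suc (suc j)) _ mm∣d =
  contradiction (trans (sym (dec-true (m * m ∣? d) mm∣d)) tests-false) λ ()
  where
  m = suc (suc j)
  j<d : j < d
  j<d = ≤-trans (n≤1+n (suc j)) (≤-trans (m≤m*n m m) (∣⇒≤ mm∣d))
  tests-false : does (m * m ∣? d) ≡ false
  tests-false = noneDivide⇒ _ (λ j → suc (suc j)) d (trans (sym (squarefree?-unfold d)) sf) j j<d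

SquareFree⇒squarefree? : ∀ d → SquareFree d → squarefree? d ≡ true
SquareFree⇒squarefree? d sf = trans (squarefree?-unfold d) (⇒noneDivide _ (λ j → suc (suc j)) d
  (λ j _ → dec-false (suc (suc j) * suc (suc j) ∣? d) (sf (suc (suc j)) (s≤s (s≤s z≤n)))))

squarefree?-* : ∀ {p n} .{{_ : NonZero n}} → Prime p → ¬ p ∣ n → squarefree? (p * n) ≡ squarefree? n
squarefree?-* {p} {n} pp p∤n with squarefree? n in sf-n | squarefree? (p * n) in sf-pn
... | true  | true  = refl
... | false | false = refl
... | true  | false = trans (sym sf-pn) (SquareFree⇒squarefree? (p * n) (SquareFree-* pp p∤n (squarefree?⇒SquareFree n sf-n)))
... | false | true  = trans (sym (SquareFree⇒squarefree? n (SquareFree-*⁻ʳ p n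
                        (squarefree?⇒SquareFree (p * n) {{m*n≢0 p n {{prime⇒nonZero pp}}}} sf-pn)))) sf-n

length-filter-upTo : ∀ {P : ℕ → Set} (P? : Decidable P) n → length (filter P? (upTo n)) ≡ count P? n
length-filter-upTo P? zero    = refl
length-filter-upTo P? (suc n) = begin
  length (filter P? (upTo (suc n)))                        ≡⟨ cong (length ∘ filter P?) (sym (List.upTo-∷ʳ n)) ⟩
  length (filter P? (upTo n ++ n ∷ []))                    ≡⟨ cong length (List.filter-++ P? (upTo n) (n ∷ [])) ⟩
  length (filter P? (upTo n) ++ filter P? (n ∷ []))        ≡⟨ List.length-++ (filter P? (upTo n)) ⟩
  length (filter P? (upTo n)) + length (filter P? (n ∷ [])) ≡⟨ cong (_+ length (filter P? (n ∷ []))) (length-filter-upTo P? n) ⟩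
  count P? n + length (filter P? (n ∷ []))                 ≡⟨ last ⟩
  count P? (suc n)                                         ∎
  where
  open ≡-Reasoning
  last : count P? n + length (filter P? (n ∷ [])) ≡ count P? (suc n)
  last with P? n
  ... | yes _ = +-comm (count P? n) 1
  ... | no  _ = +-identityʳ (count P? n)

primeDivisor? : ∀ d → Decidable (λ q → Prime q × q ∣ d)
primeDivisor? d q = prime? q ×-dec (q ∣? d)

ω : ℕ → ℕ
ω d = length (primeDivisors d)

ω≡count : ∀ d .{{_ : NonZero d}} t → ω d ≡ count (primeDivisor? d) (suc d + t)
ω≡count d t = begin
  ω d                                          ≡⟨ length-filter-upTo (primeDivisor? d) (suc d) ⟩
  count (primeDivisor? d) (suc d)              ≡⟨ sym (+-identityʳ _) ⟩
  count (primeDivisor? d) (suc d) + 0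
    ≡⟨ cong (_+_ (count (primeDivisor? d) (suc d))) (sym (count-zero (λ j → primeDivisor? d (suc d + j)) t too-large)) ⟩
  count (primeDivisor? d) (suc d) + count (λ j → primeDivisor? d (suc d + j)) t
                                               ≡⟨ sym (count-+ (primeDivisor? d) (suc d) t) ⟩
  count (primeDivisor? d) (suc d + t)          ∎
  where
  open ≡-Reasoning
  too-large : ∀ j → j < t → ¬ (Prime (suc d + j) × suc d + j ∣ d)
  too-large j _ (_ , d+1+j∣d) = <⇒≱ (m≤m+n (suc d) j) (∣⇒≤ d+1+j∣d)

ω-* : ∀ {p n} .{{_ : NonZero n}} → Prime p → ¬ p ∣ n → ω (p * n) ≡ suc (ω n)
ω-* {p} {n} pp p∤n = begin
  ω (p * n)                                                      ≡⟨ ω≡count (p * n) {{m*n≢0 p n}} 0 ⟩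
  count (primeDivisor? (p * n)) (suc (p * n + 0))                ≡⟨ cong (count (primeDivisor? (p * n)) ∘ suc) (+-identityʳ (p * n)) ⟩
  count (primeDivisor? (p * n)) (suc (p * n))                    ≡⟨ count-split (_≟ p) (primeDivisor? (p * n)) (suc (p * n)) ⟩
  count (λ q → (q ≟ p) ×-dec primeDivisor? (p * n) q) (suc (p * n)) + count others? (suc (p * n))
                                                                 ≡⟨ cong₂ _+_ just-p others ⟩
  suc (ω n)                                                      ∎
  where
  open ≡-Reasoning
  instance _ = prime⇒nonZero pp
  others? = λ q → ¬? (q ≟ p) ×-dec primeDivisor? (p * n) q
  just-p : count (λ q → (q ≟ p) ×-dec primeDivisor? (p * n) q) (suc (p * n)) ≡ 1
  just-p = count-unique (λ q → (q ≟ p) ×-dec primeDivisor? (p * n) q) (suc (p * n)) p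
                        (s≤s (m≤m*n p n)) (refl , pp , m∣m*n n) (λ _ _ → proj₁)
  others⇔ : ∀ q → (q ≢ p × Prime q × q ∣ p * n → Prime q × q ∣ n) × (Prime q × q ∣ n → q ≢ p × Prime q × q ∣ p * n)
  others⇔ q = (λ (q≢p , pq , q∣pn) → pq , [ (λ q∣p → contradiction (prime∣prime⇒≡ pq pp q∣p) q≢p) , id ] (euclidsLemma p n pq q∣pn))
            , (λ (pq , q∣n) → (λ { refl → p∤n q∣n }) , pq , ∣n⇒∣m*n p q∣n)
  others : count others? (suc (p * n)) ≡ ω n
  others = begin
    count others? (suc (p * n))                   ≡⟨ count-cong others? (primeDivisor? n) (suc (p * n)) (λ q _ → others⇔ q) ⟩
    count (primeDivisor? n) (suc (p * n))         ≡⟨ cong (count (primeDivisor? n)) (sym (m+[n∸m]≡n (s≤s (m≤n*m n p)))) ⟩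
    count (primeDivisor? n) (suc n + (p * n ∸ n)) ≡⟨ sym (ω≡count n (p * n ∸ n)) ⟩
    ω n                                           ∎

μ-* : ∀ {p n} .{{_ : NonZero n}} → Prime p → ¬ p ∣ n → μ (p * n) ≡ ℤ.- μ n
μ-* {p} {n} pp p∤n rewrite squarefree?-* pp p∤n with squarefree? n
... | true  = trans (cong (ℤ.-1ℤ ℤ.^_) (ω-* pp p∤n)) (ℤₚ.-1*i≡-i _)
... | false = refl

∣μ∣≤1 : ∀ d → ℤ.∣ μ d ∣ ≤ 1
∣μ∣≤1 d with squarefree? d
... | true  = ≤-reflexive (∣-1^n∣≡1 (ω d))
  where
  ∣-1^n∣≡1 : ∀ n → ℤ.∣ ℤ.-1ℤ ℤ.^ n ∣ ≡ 1
  ∣-1^n∣≡1 zero    = refl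
  ∣-1^n∣≡1 (suc n) = trans (ℤₚ.abs-* ℤ.-1ℤ (ℤ.-1ℤ ℤ.^ n)) (trans (*-identityˡ _) (∣-1^n∣≡1 n))
... | false = z≤n

μ≢0⇒SquareFree : ∀ d .{{_ : NonZero d}} → μ d ≢ ℤ.0ℤ → SquareFree d
μ≢0⇒SquareFree d μ≢0 with squarefree? d in sf
... | true  = squarefree?⇒SquareFree d sf
... | false = contradiction refl μ≢0

-- The Euler product

prodℚ-snoc : ∀ xs y → prodℚ (xs ++ y ∷ []) ≡ prodℚ xs ℚ.* y
prodℚ-snoc []       y = trans (ℚₚ.*-identityʳ y) (sym (ℚₚ.*-identityˡ y))
prodℚ-snoc (x ∷ xs) y = trans (cong (x ℚ.*_) (prodℚ-snoc xs y)) (sym (ℚₚ.*-assoc x _ y))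

∑-multiples : ∀ q .{{_ : NonZero q}} (F : ℕ → ℚ) E →
              ∑[ m < q * E ] when (q ∣? suc m) (F (suc m)) ≡ ∑[ e < E ] F (q * suc e)
∑-multiples q F zero    = cong (λ n → ∑[ m < n ] when (q ∣? suc m) (F (suc m))) (*-zeroʳ q)
∑-multiples q@(suc q′) F (suc E) = begin
  ∑ (q * suc E) H                                  ≡⟨ cong (λ n → ∑ n H) (trans (*-suc q E) (+-comm q (q * E))) ⟩
  ∑ (q * E + q) H                                  ≡⟨ ∑-split (q * E) q H ⟩
  ∑ (q * E) H ℚ.+ ∑[ i < q ] H (q * E + i)          ≡⟨ cong₂ ℚ._+_ (∑-multiples q F E) block ⟩
  ∑[ e < E ] F (q * suc e) ℚ.+ F (q * suc E)        ≡⟨ sym (∑-snoc E (λ e → F (q * suc e))) ⟩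
  ∑[ e < suc E ] F (q * suc e)                      ∎
  where
  open ≡-Reasoning
  H : ℕ → ℚ
  H m = when (q ∣? suc m) (F (suc m))
  block : ∑[ i < q ] H (q * E + i) ≡ F (q * suc E)
  block = begin
    ∑[ i < suc q′ ] H (q * E + i)                   ≡⟨ ∑-snoc q′ (λ i → H (q * E + i)) ⟩
    ∑[ i < q′ ] H (q * E + i) ℚ.+ H (q * E + q′)    ≡⟨ cong₂ ℚ._+_ (∑-zero q′ not-multiple) (cong (λ x → when (q ∣? x) (F x)) last≡) ⟩
    0ℚ ℚ.+ when (q ∣? q * suc E) (F (q * suc E))    ≡⟨ ℚₚ.+-identityˡ _ ⟩
    when (q ∣? q * suc E) (F (q * suc E))           ≡⟨ when-yes (q ∣? q * suc E) _ (m∣m*n (suc E)) ⟩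
    F (q * suc E)                                   ∎
    where
    last≡ : suc (q * E + q′) ≡ q * suc E
    last≡ = trans (sym (+-suc (q * E) q′)) (trans (+-comm (q * E) q) (sym (*-suc q E)))
    not-multiple : ∀ i → i < q′ → H (q * E + i) ≡ 0ℚ
    not-multiple i i<q′ = when-no (q ∣? suc (q * E + i)) _ λ q∣ →
      <⇒≱ (s≤s i<q′) (∣⇒≤ (∣m+n∣m⇒∣n (subst (q ∣_) (sym (+-suc (q * E) i)) q∣) (m∣m*n E)))

primorial : ℕ → ℕ
primorial zero = 1
primorial (suc P) with prime? (suc P)
... | yes _ = suc P * primorial P
... | no  _ = primorial P

primorial-prime : ∀ P → Prime (suc P) → primorial (suc P) ≡ suc P * primorial P
primorial-prime P pp with prime? (suc P)
... | yes _ = refl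
... | no ¬p = contradiction pp ¬p

primorial-¬prime : ∀ P → ¬ Prime (suc P) → primorial (suc P) ≡ primorial P
primorial-¬prime P ¬p with prime? (suc P)
... | yes pp = contradiction pp ¬p
... | no  _  = refl

primorial≢0 : ∀ P → NonZero (primorial P)
primorial≢0 zero = _
primorial≢0 (suc P) with prime? (suc P)
... | yes _ = m*n≢0 (suc P) (primorial P) {{_}} {{primorial≢0 P}}
... | no  _ = primorial≢0 P

prime∣primorial⇒≤ : ∀ P {p} → Prime p → p ∣ primorial P → p ≤ P
prime∣primorial⇒≤ zero    pp p∣1 = contradiction p∣1 (prime∤1 pp)
prime∣primorial⇒≤ (suc P) pp p∣ with prime? (suc P)
... | no _ = m≤n⇒m≤1+n (prime∣primorial⇒≤ P pp p∣)
... | yes pP with euclidsLemma (suc P) (primorial P) pp p∣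
...   | inj₁ p∣P+1 = ≤-reflexive (prime∣prime⇒≡ pp pP p∣P+1)
...   | inj₂ p∣Q   = m≤n⇒m≤1+n (prime∣primorial⇒≤ P pp p∣Q)

SquareFree⇒∣primorial : ∀ P d .{{_ : NonZero d}} → SquareFree d → (∀ p → Prime p → p ∣ d → p ≤ P) →
                        d ∣ primorial P
SquareFree⇒∣primorial zero 1 sf small = ∣-refl
SquareFree⇒∣primorial zero d@(suc (suc _)) sf small with ∃prime∣ d (s≤s (s≤s z≤n))
... | p , pp , p∣d = contradiction (≤-trans (nonTrivial⇒n>1 p {{prime⇒nonTrivial pp}}) (small p pp p∣d)) λ ()
SquareFree⇒∣primorial (suc P) d sf small with prime? (suc P)
... | no ¬p = SquareFree⇒∣primorial P d sf (λ p pp p∣d → below p pp p∣d λ { refl → ¬p pp })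
  where
  below : ∀ p → Prime p → p ∣ d → p ≢ suc P → p ≤ P
  below p pp p∣d p≢ = ≤-pred (≤∧≢⇒< (small p pp p∣d) p≢)
... | yes pP with suc P ∣? d
...   | no  P+1∤d = ∣n⇒∣m*n (suc P) (SquareFree⇒∣primorial P d sf
                     (λ p pp p∣d → ≤-pred (≤∧≢⇒< (small p pp p∣d) λ { refl → P+1∤d p∣d })))
...   | yes (divides d′ refl) = subst (_∣ suc P * primorial P) (*-comm (suc P) d′) (*-monoʳ-∣ (suc P) d′∣Q)
  where
  q = suc P
  instance
    d′≢0 : NonZero d′
    d′≢0 = ≢-nonZero λ d′≡0 → ≢-nonZero⁻¹ (d′ * q) (cong (_* q) d′≡0)
  q∤d′ : ¬ q ∣ d′
  q∤d′ q∣d′ = sf q (nonTrivial⇒n>1 q {{prime⇒nonTrivial pP}}) (subst (q * q ∣_) (*-comm q d′) (*-monoʳ-∣ q q∣d′))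
  d′∣Q : d′ ∣ primorial P
  d′∣Q = SquareFree⇒∣primorial P d′ (SquareFree-*⁻ʳ q d′ (subst SquareFree (*-comm d′ q) sf))
           (λ p pp p∣d′ → ≤-pred (≤∧≢⇒< (small p pp (∣m⇒∣m*n q p∣d′)) λ { refl → q∤d′ p∣d′ }))

module EulerProduct (k a b r : ℕ) where

  γ : ℕ → ℕ
  γ d = gcd (gcd a b) (d ^ k)

  weight : ℕ → ℚ
  weight zero        = 0ℚ
  weight d@(suc _) = when (γ d ∣? r) (frac (μ d ℤ.* + γ d) (d ^ k) {{m^n≢0 d k}})

  ρ : ℕ → ℚ
  ρ zero        = 0ℚ
  ρ p@(suc _) = when (γ p ∣? r) (frac (+ γ p) (p ^ k) {{m^n≢0 p k}})

  factor-prime : ∀ p → Prime p → factor k a b r p ≡ 1ℚ ℚ.- ρ p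
  factor-prime p@(suc _) pp with prime? p ×-dec (γ p ∣? r)
  ... | yes (_ , γ∣r) = cong (ℚ._-_ 1ℚ) (sym (trans (when-yes (γ p ∣? r) _ γ∣r) (frac≡/ (+ γ p) (p ^ k) {{m^n≢0 p k}})))
  ... | no ¬pp×γ∣r    = sym (trans (cong (ℚ._-_ 1ℚ) (when-no (γ p ∣? r) _ (λ γ∣r → ¬pp×γ∣r (pp , γ∣r))))
                                   (ℚₚ.+-identityʳ 1ℚ))

  factor-¬prime : ∀ p → ¬ Prime p → factor k a b r p ≡ 1ℚ
  factor-¬prime p ¬pp with prime? p ×-dec (γ p ∣? r)
  ... | yes (pp , _) = contradiction pp ¬pp
  ... | no _         = refl

  θpartial-suc : ∀ P → θpartial k a b r (suc P) ≡ θpartial k a b r P ℚ.* factor k a b r (suc P)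
  θpartial-suc P = begin
    prodℚ (map F (upTo (suc (suc P))))               ≡⟨ cong (prodℚ ∘ map F) (sym (List.upTo-∷ʳ (suc P))) ⟩
    prodℚ (map F (upTo (suc P) ++ suc P ∷ []))       ≡⟨ cong prodℚ (List.map-++ F (upTo (suc P)) (suc P ∷ [])) ⟩
    prodℚ (map F (upTo (suc P)) ++ F (suc P) ∷ [])   ≡⟨ prodℚ-snoc (map F (upTo (suc P))) (F (suc P)) ⟩
    θpartial k a b r P ℚ.* F (suc P)                 ∎
    where
    open ≡-Reasoning
    F = factor k a b r

  module _ {p n} (pp : Prime p) (p∤n : ¬ p ∣ n) where

    γ-* : γ (p * n) ≡ γ p * γ n
    γ-* = trans (cong (gcd (gcd a b)) (^-distribʳ-* p n k))
                (gcd-multiplicative (gcd a b) (p ^ k) (n ^ k) (coprime-pow k pp p∤n))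

    γ-coprime : Coprime (γ p) (γ n)
    γ-coprime = coprime-∣ (coprime-pow k pp p∤n) (gcd[m,n]∣n (gcd a b) (p ^ k)) (gcd[m,n]∣n (gcd a b) (n ^ k))

    module _ .{{_ : NonZero p}} .{{_ : NonZero n}} where

      private instance
        pᵏ≢0 = m^n≢0 p k
        nᵏ≢0 = m^n≢0 n k
        pn≢0 = m*n≢0 p n
        [pn]ᵏ≢0 = m^n≢0 (p * n) k
        pᵏnᵏ≢0 = m*n≢0 (p ^ k) (n ^ k)

      fraction-* : frac (μ (p * n) ℤ.* + γ (p * n)) ((p * n) ^ k) ≡
                   ℚ.- (frac (+ γ p) (p ^ k) ℚ.* frac (μ n ℤ.* + γ n) (n ^ k))
      fraction-* = begin
        frac (μ (p * n) ℤ.* + γ (p * n)) ((p * n) ^ k)      ≡⟨ frac≡/ (μ (p * n) ℤ.* + γ (p * n)) ((p * n) ^ k) ⟩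
        (μ (p * n) ℤ.* + γ (p * n)) / (p * n) ^ k
          ≡⟨ /-cross-≡ (μ (p * n) ℤ.* + γ (p * n)) (ℤ.- (+ γ p ℤ.* (μ n ℤ.* + γ n))) ((p * n) ^ k) (p ^ k * n ^ k) cross ⟩
        ℤ.- (+ γ p ℤ.* (μ n ℤ.* + γ n)) / (p ^ k * n ^ k)   ≡⟨ sym (neg-/ (+ γ p ℤ.* (μ n ℤ.* + γ n)) (p ^ k * n ^ k)) ⟩
        ℚ.- ((+ γ p ℤ.* (μ n ℤ.* + γ n)) / (p ^ k * n ^ k)) ≡⟨ cong ℚ.-_ (sym (/-* (+ γ p) (μ n ℤ.* + γ n) (p ^ k) (n ^ k))) ⟩
        ℚ.- ((+ γ p / p ^ k) ℚ.* ((μ n ℤ.* + γ n) / n ^ k))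
          ≡⟨ cong ℚ.-_ (sym (cong₂ ℚ._*_ (frac≡/ (+ γ p) (p ^ k)) (frac≡/ (μ n ℤ.* + γ n) (n ^ k)))) ⟩
        ℚ.- (frac (+ γ p) (p ^ k) ℚ.* frac (μ n ℤ.* + γ n) (n ^ k)) ∎
        where
        open ≡-Reasoning
        regroup : ∀ m x y z → ℤ.- m ℤ.* (x ℤ.* y) ℤ.* z ≡ ℤ.- (x ℤ.* (m ℤ.* y)) ℤ.* z
        regroup = ℤ-Ring.solve-∀
        Z = + (p ^ k * n ^ k)
        cross : μ (p * n) ℤ.* + γ (p * n) ℤ.* Z ≡ ℤ.- (+ γ p ℤ.* (μ n ℤ.* + γ n)) ℤ.* + ((p * n) ^ k)
        cross = begin
          μ (p * n) ℤ.* + γ (p * n) ℤ.* Z                 ≡⟨ cong₂ (λ u v → u ℤ.* v ℤ.* Z) (μ-* pp p∤n) (cong +_ γ-*) ⟩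
          ℤ.- μ n ℤ.* + (γ p * γ n) ℤ.* Z                 ≡⟨ cong (λ v → ℤ.- μ n ℤ.* v ℤ.* Z) (ℤₚ.pos-* (γ p) (γ n)) ⟩
          ℤ.- μ n ℤ.* (+ γ p ℤ.* + γ n) ℤ.* Z             ≡⟨ regroup (μ n) (+ γ p) (+ γ n) Z ⟩
          ℤ.- (+ γ p ℤ.* (μ n ℤ.* + γ n)) ℤ.* Z           ≡⟨ cong (λ v → ℤ.- (+ γ p ℤ.* (μ n ℤ.* + γ n)) ℤ.* + v) (sym (^-distribʳ-* p n k)) ⟩
          ℤ.- (+ γ p ℤ.* (μ n ℤ.* + γ n)) ℤ.* + ((p * n) ^ k) ∎

  weight-* : ∀ {p n} → Prime p → ¬ p ∣ n → weight (p * n) ≡ ℚ.- (ρ p ℚ.* weight n)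
  weight-* {zero}   pp _   = contradiction refl (≢-nonZero⁻¹ 0 {{prime⇒nonZero pp}})
  weight-* {suc _} {zero}  _  p∤0 = contradiction (_ ∣0) p∤0
  weight-* {p@(suc _)} {n@(suc _)} pp p∤n with γ p ∣? r | γ n ∣? r | γ (p * n) ∣? r
  ... | yes _   | yes _   | yes _    = fraction-* pp p∤n
  ... | yes γp∣ | yes γn∣ | no γpn∤  = contradiction (subst (_∣ r) (sym (γ-* pp p∤n)) (coprime⇒*∣ (γ-coprime pp p∤n) γp∣ γn∣)) γpn∤
  ... | no γp∤  | _       | yes γpn∣ = contradiction (∣-trans (subst (γ p ∣_) (sym (γ-* pp p∤n)) (m∣m*n (γ n))) γpn∣) γp∤
  ... | yes _   | no γn∤  | yes γpn∣ = contradiction (∣-trans (subst (γ n ∣_) (sym (γ-* pp p∤n)) (n∣m*n (γ p))) γpn∣) γn∤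
  ... | no _    | γn?     | no _     = cong ℚ.-_ (sym (ℚₚ.*-zeroˡ (when γn? (frac (μ n ℤ.* + γ n) (n ^ k) {{m^n≢0 n k}}))))
  ... | yes _   | no _    | no _     = cong ℚ.-_ (sym (ℚₚ.*-zeroʳ (frac (+ γ p) (p ^ k) {{m^n≢0 p k}})))

  weight-1 : weight 1 ≡ 1ℚ
  weight-1 = begin
    weight 1                                   ≡⟨ when-yes (γ 1 ∣? r) _ (subst (_∣ r) (sym γ1≡1) (1∣ r)) ⟩
    frac (μ 1 ℤ.* + γ 1) (1 ^ k) {{m^n≢0 1 k}} ≡⟨ frac≡/ (μ 1 ℤ.* + γ 1) (1 ^ k) {{m^n≢0 1 k}} ⟩
    _/_ (μ 1 ℤ.* + γ 1) (1 ^ k) {{m^n≢0 1 k}}  ≡⟨ /-cross-≡ (μ 1 ℤ.* + γ 1) (+ 1) (1 ^ k) 1 {{m^n≢0 1 k}} cross ⟩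
    1ℚ                                         ∎
    where
    open ≡-Reasoning
    γ1≡1 : γ 1 ≡ 1
    γ1≡1 = trans (cong (gcd (gcd a b)) (^-zeroˡ k)) (gcd-zeroʳ (gcd a b))
    cross : μ 1 ℤ.* + γ 1 ℤ.* + 1 ≡ + 1 ℤ.* + (1 ^ k)
    cross = trans (cong (λ g → μ 1 ℤ.* + g ℤ.* + 1) γ1≡1) (cong (λ x → + 1 ℤ.* + x) (sym (^-zeroˡ k)))

  divisorSum : ℕ → ℕ → ℚ
  divisorSum n D = ∑[ m < D ] when (suc m ∣? n) (weight (suc m))

  when-∣-split : ∀ {q n} d v → Prime q → ¬ q ∣ n →
                 when (d ∣? q * n) v ≡ when (d ∣? n) v ℚ.+ when (q ∣? d) (when (d ∣? q * n) v)
  when-∣-split {q} {n} d v pq q∤n with d ∣? n | q ∣? d | d ∣? q * n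
  ... | yes d∣n | yes q∣d | _        = contradiction (∣-trans q∣d d∣n) q∤n
  ... | yes _   | no _    | yes _    = sym (ℚₚ.+-identityʳ v)
  ... | yes d∣n | no _    | no d∤qn  = contradiction (∣n⇒∣m*n q d∣n) d∤qn
  ... | no _    | yes _   | yes _    = sym (ℚₚ.+-identityˡ v)
  ... | no _    | yes _   | no _     = refl
  ... | no d∤n  | no q∤d  | yes d∣qn = contradiction (Coprimality.coprime-divisor (Coprimality.sym (prime∤⇒coprime pq q∤d)) d∣qn) d∤n
  ... | no _    | no _    | no _     = refl

  divisorSum-* : ∀ {q n} → Prime q → ¬ q ∣ n → ∀ D →
                 divisorSum (q * n) (q * D) ≡ divisorSum n (q * D) ℚ.+ ℚ.- ρ q ℚ.* divisorSum n D
  divisorSum-* {q} {n} pq q∤n D = begin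
    divisorSum (q * n) (q * D)
      ≡⟨ ∑-cong (q * D) (λ m _ → when-∣-split (suc m) (weight (suc m)) pq q∤n) ⟩
    ∑[ m < q * D ] (W m ℚ.+ when (q ∣? suc m) (F (suc m)))
      ≡⟨ ∑-+ (q * D) W (λ m → when (q ∣? suc m) (F (suc m))) ⟩
    divisorSum n (q * D) ℚ.+ ∑[ m < q * D ] when (q ∣? suc m) (F (suc m))
      ≡⟨ cong (divisorSum n (q * D) ℚ.+_) (∑-multiples q F D) ⟩
    divisorSum n (q * D) ℚ.+ ∑[ e < D ] F (q * suc e)
      ≡⟨ cong (divisorSum n (q * D) ℚ.+_) (trans (∑-cong D (λ e _ → multiple e)) (∑-*ˡ D (ℚ.- ρ q) W)) ⟩
    divisorSum n (q * D) ℚ.+ ℚ.- ρ q ℚ.* divisorSum n D ∎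
    where
    open ≡-Reasoning
    instance _ = prime⇒nonZero pq
    W : ℕ → ℚ
    W m = when (suc m ∣? n) (weight (suc m))
    F : ℕ → ℚ
    F d = when (d ∣? q * n) (weight d)
    multiple : ∀ e → F (q * suc e) ≡ ℚ.- ρ q ℚ.* W e
    multiple e with suc e ∣? n | q * suc e ∣? q * n
    ... | yes e∣n | yes _    = trans (weight-* pq (λ q∣e → q∤n (∣-trans q∣e e∣n))) (ℚₚ.neg-distribˡ-* (ρ q) (weight (suc e)))
    ... | yes e∣n | no qe∤qn = contradiction (*-monoʳ-∣ q e∣n) qe∤qn
    ... | no e∤n  | yes qe∣qn = contradiction (*-cancelˡ-∣ q qe∣qn) e∤n
    ... | no _    | no _     = sym (ℚₚ.*-zeroʳ (ℚ.- ρ q))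

  euler-product : ∀ P X .{{_ : NonZero X}} → divisorSum (primorial P) (primorial P * X) ≡ θpartial k a b r P
  euler-product zero (suc X) = begin
    divisorSum 1 (suc X + 0)                            ≡⟨ cong (divisorSum 1) (+-identityʳ (suc X)) ⟩
    weight 1 ℚ.+ ∑[ m < X ] when (2 + m ∣? 1) (weight (2 + m))
      ≡⟨ cong₂ ℚ._+_ weight-1 (∑-zero X (λ m _ → when-no (2 + m ∣? 1) (weight (2 + m))
                                               (λ 2+m∣1 → contradiction (∣⇒≤ 2+m∣1) λ { (s≤s ()) }))) ⟩
    1ℚ ℚ.+ 0ℚ                                           ≡⟨ ℚₚ.+-identityʳ 1ℚ ⟩
    1ℚ                                                  ≡⟨ cong (ℚ._* 1ℚ) (sym (factor-¬prime 0 λ ())) ⟩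
    θpartial k a b r zero                               ∎
    where open ≡-Reasoning
  euler-product (suc P) X = step (prime? (suc P))
    where
    open ≡-Reasoning
    Q = primorial P
    θ = θpartial k a b r P
    step : Dec (Prime (suc P)) → divisorSum (primorial (suc P)) (primorial (suc P) * X) ≡ θpartial k a b r (suc P)
    step (no ¬p) = begin
      divisorSum (primorial (suc P)) (primorial (suc P) * X) ≡⟨ cong (λ n → divisorSum n (n * X)) (primorial-¬prime P ¬p) ⟩
      divisorSum Q (Q * X)                                   ≡⟨ euler-product P X ⟩
      θ                                                      ≡⟨ sym (ℚₚ.*-identityʳ θ) ⟩
      θ ℚ.* 1ℚ                                               ≡⟨ cong (θ ℚ.*_) (sym (factor-¬prime (suc P) ¬p)) ⟩
      θ ℚ.* factor k a b r (suc P)                           ≡⟨ sym (θpartial-suc P) ⟩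
      θpartial k a b r (suc P)                               ∎
    step (yes pq) = begin
      divisorSum (primorial (suc P)) (primorial (suc P) * X) ≡⟨ cong (λ n → divisorSum n (n * X)) (primorial-prime P pq) ⟩
      divisorSum (q * Q) (q * Q * X)                         ≡⟨ cong (divisorSum (q * Q)) (*-assoc q Q X) ⟩
      divisorSum (q * Q) (q * (Q * X))                       ≡⟨ divisorSum-* pq q∤Q (Q * X) ⟩
      divisorSum Q (q * (Q * X)) ℚ.+ ℚ.- ρ q ℚ.* divisorSum Q (Q * X)
        ≡⟨ cong₂ (λ u v → u ℚ.+ ℚ.- ρ q ℚ.* v) (trans (cong (divisorSum Q) swap) (euler-product P (q * X) {{m*n≢0 q X}}))
                                                (euler-product P X) ⟩
      θ ℚ.+ ℚ.- ρ q ℚ.* θ                                    ≡⟨ factor-out θ (ρ q) ⟩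
      θ ℚ.* (1ℚ ℚ.- ρ q)                                     ≡⟨ cong (θ ℚ.*_) (sym (factor-prime q pq)) ⟩
      θ ℚ.* factor k a b r q                                 ≡⟨ sym (θpartial-suc P) ⟩
      θpartial k a b r q                                     ∎
      where
      q = suc P
      q∤Q : ¬ q ∣ Q
      q∤Q q∣Q = <-irrefl refl (prime∣primorial⇒≤ P pq q∣Q)
      swap : q * (Q * X) ≡ Q * (q * X)
      swap = trans (sym (*-assoc q Q X)) (trans (cong (_* X) (*-comm q Q)) (*-assoc Q q X))
      factor-out : ∀ t x → t ℚ.+ ℚ.- x ℚ.* t ≡ t ℚ.* (1ℚ ℚ.- x)
      factor-out = solve 2 (λ t x → t :+ (:- x) :* t := t :* (con 1ℚ :- x)) refl
        where open ℚ-Solver.+-*-Solver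

  weight-vanishes : ∀ P m → suc m ≤ P → ¬ suc m ∣ primorial P → weight (suc m) ≡ 0ℚ
  weight-vanishes P m m<P d∤Q with μ (suc m) ℤ.≟ ℤ.0ℤ
  ... | no μ≢0 = contradiction (SquareFree⇒∣primorial P (suc m) (μ≢0⇒SquareFree (suc m) μ≢0)
                                  (λ p _ p∣d → ≤-trans (∣⇒≤ p∣d) m<P)) d∤Q
  ... | yes μ≡0 = when-zero (γ (suc m) ∣? r)
    where
    instance _ = m^n≢0 (suc m) k
    zero-fraction : frac (μ (suc m) ℤ.* + γ (suc m)) (suc m ^ k) ≡ 0ℚ
    zero-fraction = begin
      frac (μ (suc m) ℤ.* + γ (suc m)) (suc m ^ k) ≡⟨ frac≡/ (μ (suc m) ℤ.* + γ (suc m)) (suc m ^ k) ⟩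
      (μ (suc m) ℤ.* + γ (suc m)) / suc m ^ k      ≡⟨ cong (λ z → (z ℤ.* + γ (suc m)) / suc m ^ k) μ≡0 ⟩
      ℤ.0ℤ / suc m ^ k                              ≡⟨ ℚₚ.0/n≡0 (suc m ^ k) ⟩
      0ℚ                                            ∎
      where open ≡-Reasoning
    when-zero : (γ∣? : Dec (γ (suc m) ∣ r)) → when γ∣? (frac (μ (suc m) ℤ.* + γ (suc m)) (suc m ^ k)) ≡ 0ℚ
    when-zero (yes _) = zero-fraction
    when-zero (no _)  = refl

-- 1/x² + 2/(x+1) ≤ 2/x makes 2/(s+1) dominate the tail ∑_{d > s} 1/d².
∑-inverse-squares : ∀ s L → ∑[ i < L ] (+ 1 / (suc (s + i) * suc (s + i))) ℚ.≤ + 2 / suc s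
∑-inverse-squares s L = ℚₚ.≤-trans
  (ℚₚ.≤-trans (ℚₚ.≤-reflexive (sym (ℚₚ.+-identityʳ (∑ L (F s)))))
              (ℚₚ.+-monoʳ-≤ (∑ L (F s)) (ℚₚ.nonNegative⁻¹ (+ 2 / suc (s + L)) {{ℚₚ.normalize-nonNeg 2 (suc (s + L))}})))
  (telescope s L)
  where
  F : ℕ → ℕ → ℚ
  F s i = + 1 / (suc (s + i) * suc (s + i))
  step : ∀ x → + 1 / (suc x * suc x) ℚ.+ + 2 / suc (suc x) ℚ.≤ + 2 / suc x
  step x = begin
    + 1 / (y * y) ℚ.+ + 2 / suc y                                      ≡⟨ /-+ (+ 1) (+ 2) (y * y) (suc y) ⟩
    _/_ (+ 1 ℤ.* + suc y ℤ.+ + 2 ℤ.* + (y * y)) (y * y * suc y) {{yysy≢0}}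
      ≡⟨ cong (λ z → _/_ z (y * y * suc y) {{yysy≢0}}) (cong₂ ℤ._+_ (ℤₚ.*-identityˡ (+ suc y)) (sym (ℤₚ.pos-* 2 (y * y)))) ⟩
    _/_ (+ (suc y + 2 * (y * y))) (y * y * suc y) {{yysy≢0}}            ≤⟨ /-cross-≤ℕ (suc y + 2 * (y * y)) 2 (y * y * suc y) y {{yysy≢0}} cross ⟩
    + 2 / y                                                            ∎
    where
    open ℚₚ.≤-Reasoning
    y = suc x
    yysy≢0 = m*n≢0 (y * y) (suc y)
    lhs : ∀ y → (suc y + 2 * (y * y)) * y ≡ y + (y * y + 2 * (y * y * y))
    lhs = ℕ-Ring.solve-∀
    rhs : ∀ y → 2 * (y * y * suc y) ≡ y * y + (y * y + 2 * (y * y * y))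
    rhs = ℕ-Ring.solve-∀
    cross : (suc y + 2 * (y * y)) * y ≤ 2 * (y * y * suc y)
    cross = subst₂ _≤_ (sym (lhs y)) (sym (rhs y)) (+-monoˡ-≤ _ (m≤m*n y y))
  telescope : ∀ s L → ∑ L (F s) ℚ.+ + 2 / suc (s + L) ℚ.≤ + 2 / suc s
  telescope s zero = ℚₚ.≤-reflexive (trans (ℚₚ.+-identityˡ _) (cong (λ z → + 2 / suc z) (+-identityʳ s)))
  telescope s (suc L) = begin
    ∑ (suc L) (F s) ℚ.+ + 2 / suc (s + suc L)              ≡⟨ cong₂ ℚ._+_ (∑-snoc L (F s)) (cong (λ z → + 2 / suc z) (+-suc s L)) ⟩
    (∑ L (F s) ℚ.+ F s L) ℚ.+ + 2 / suc (suc (s + L))      ≡⟨ ℚₚ.+-assoc (∑ L (F s)) (F s L) (+ 2 / suc (suc (s + L))) ⟩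
    ∑ L (F s) ℚ.+ (F s L ℚ.+ + 2 / suc (suc (s + L)))      ≤⟨ ℚₚ.+-monoʳ-≤ (∑ L (F s)) (step (s + L)) ⟩
    ∑ L (F s) ℚ.+ + 2 / suc (s + L)                        ≤⟨ telescope s L ⟩
    + 2 / suc s                                            ∎
    where open ℚₚ.≤-Reasoning

iroot : ℕ → ℕ → ℕ
iroot k zero    = 0
iroot k (suc n) with suc (iroot k n) ^ k ≤? suc n
... | yes _ = suc (iroot k n)
... | no  _ = iroot k n

iroot-spec : ∀ k .{{_ : NonZero k}} n → iroot k n ^ k ≤ n × n < suc (iroot k n) ^ k
iroot-spec k@(suc _) zero = z≤n , subst (0 <_) (sym (^-zeroˡ k)) z<s
iroot-spec k (suc n) with iroot-spec k n | suc (iroot k n) ^ k ≤? suc n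
... | _ , n<[y+1]ᵏ | yes [y+1]ᵏ≤ = [y+1]ᵏ≤ , ≤-<-trans n<[y+1]ᵏ (^-monoˡ-< k (n<1+n (suc (iroot k n))))
... | yᵏ≤n , _     | no  [y+1]ᵏ≰ = ≤-trans yᵏ≤n (n≤1+n n) , ≰⇒> [y+1]ᵏ≰

m≤m^k : ∀ m k .{{_ : NonZero m}} → 1 ≤ k → m ≤ m ^ k
m≤m^k m k 1≤k = subst (_≤ m ^ k) (*-identityʳ m) (^-monoʳ-≤ m 1≤k)

iroot≥1 : ∀ k .{{_ : NonZero k}} n → 1 ≤ n → 1 ≤ iroot k n
iroot≥1 k n 1≤n with iroot k n | proj₂ (iroot-spec k n)
... | suc _ | _        = s≤s z≤n
... | zero  | n<1ᵏ = contradiction (subst (n <_) (^-zeroˡ k) n<1ᵏ) (≤⇒≯ 1≤n)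

∣+m-+n∣≡m∸n : ∀ {m n} → n ≤ m → ℤ.∣ + m ℤ.- + n ∣ ≡ m ∸ n
∣+m-+n∣≡m∸n {m} {n} n≤m = trans (cong ℤ.∣_∣ (ℤₚ.[+m]-[+n]≡m⊖n m n)) (trans (ℤₚ.∣m⊖n∣≡∣n⊖m∣ m n) (ℤₚ.∣⊖∣-≤ n≤m))

∣+m-+n∣≡n∸m : ∀ {m n} → m ≤ n → ℤ.∣ + m ℤ.- + n ∣ ≡ n ∸ m
∣+m-+n∣≡n∸m {m} {n} m≤n = trans (cong ℤ.∣_∣ (ℤₚ.[+m]-[+n]≡m⊖n m n)) (ℤₚ.∣⊖∣-≤ m≤n)

absDiff-cases : ∀ a b → (absDiff a b + b ≡ a) ⊎ (absDiff a b + a ≡ b)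
absDiff-cases a b with ≤-total b a
... | inj₁ b≤a = inj₁ (trans (cong (_+ b) (∣+m-+n∣≡m∸n b≤a)) (m∸n+n≡m b≤a))
... | inj₂ a≤b = inj₂ (trans (cong (_+ a) (∣+m-+n∣≡n∸m a≤b)) (m∸n+n≡m a≤b))

absDiff≢0 : ∀ {a b} → a ≢ b → NonZero (absDiff a b)
absDiff≢0 {a} {b} a≢b with absDiff a b | absDiff-cases a b
... | suc _ | _         = _
... | zero  | inj₁ b≡a = contradiction (sym b≡a) a≢b
... | zero  | inj₂ a≡b = contradiction a≡b a≢b

gcd[b,∣a-b∣]≡gcd[a,b] : ∀ a b → gcd b (absDiff a b) ≡ gcd a b
gcd[b,∣a-b∣]≡gcd[a,b] a b = ∣-antisym (gcd-greatest x∣a (gcd[m,n]∣m b δ)) (gcd-greatest (gcd[m,n]∣n a b) y∣δ)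
  where
  δ = absDiff a b
  x = gcd b δ
  y = gcd a b
  x∣a : x ∣ a
  x∣a with absDiff-cases a b
  ... | inj₁ δ+b≡a = subst (x ∣_) δ+b≡a (∣m∣n⇒∣m+n (gcd[m,n]∣n b δ) (gcd[m,n]∣m b δ))
  ... | inj₂ δ+a≡b = ∣m+n∣m⇒∣n (subst (x ∣_) (sym δ+a≡b) (gcd[m,n]∣m b δ)) (gcd[m,n]∣n b δ)
  y∣δ : y ∣ δ
  y∣δ with absDiff-cases a b
  ... | inj₁ δ+b≡a = ∣m+n∣m⇒∣n (subst (y ∣_) (sym (trans (+-comm b δ) δ+b≡a)) (gcd[m,n]∣m a b)) (gcd[m,n]∣n a b)
  ... | inj₂ δ+a≡b = ∣m+n∣m⇒∣n (subst (y ∣_) (sym (trans (+-comm a δ) δ+a≡b)) (gcd[m,n]∣n a b)) (gcd[m,n]∣m a b)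

∣+m-+n∣≤ : ∀ m n e → m ≤ n + e → n ≤ m + e → ℤ.∣ + m ℤ.- + n ∣ ≤ e
∣+m-+n∣≤ m n e m≤n+e n≤m+e with ≤-total m n
... | inj₁ m≤n = subst (_≤ e) (sym (∣+m-+n∣≡n∸m m≤n)) (m≤n+o⇒m∸n≤o n m n≤m+e)
... | inj₂ n≤m = subst (_≤ e) (sym (∣+m-+n∣≡m∸n n≤m)) (m≤n+o⇒m∸n≤o m n m≤n+e)

-- The main estimate

module Estimate (k a b r : ℕ) (k≥2 : 2 ≤ k) (a≥1 : 1 ≤ a) (a≢b : a ≢ b) where

  open EulerProduct k a b r

  instance
    k≢0 : NonZero k
    k≢0 = >-nonZero (≤-trans (s≤s z≤n) k≥2)
    a≢0 : NonZero a
    a≢0 = >-nonZero a≥1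
    δ≢0 : NonZero (absDiff a b)
    δ≢0 = absDiff≢0 a≢b
    dᵏ≢0 : ∀ {m} → NonZero (suc m ^ k)
    dᵏ≢0 {m} = m^n≢0 (suc m) k

  δ : ℕ
  δ = absDiff a b

  K : ℕ
  K = 6 * δ + 2

  g : ℕ → ℕ
  g m = gcd δ (suc m ^ k)

  g≢0 : ∀ m → NonZero (g m)
  g≢0 m = ≢-nonZero (gcd[m,n]≢0 δ (suc m ^ k) (inj₁ (≢-nonZero⁻¹ δ)))

  γ∣b : ∀ m → γ (suc m) ∣ b
  γ∣b m = ∣-trans (gcd[m,n]∣m (gcd a b) (suc m ^ k)) (gcd[m,n]∣n a b)

  gcd[b,g]≡γ : ∀ m → gcd b (g m) ≡ γ (suc m)
  gcd[b,g]≡γ m = trans (sym (gcd-assoc b δ (suc m ^ k))) (cong (λ x → gcd x (suc m ^ k)) (gcd[b,∣a-b∣]≡gcd[a,b] a b))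

  shift : ∀ j → b * suc j + r ≡ b * j + (b + r)
  shift j = trans (cong (_+ r) (trans (*-suc b j) (+-comm b (b * j)))) (+-assoc (b * j) b r)

  summand : ℕ → ℚ
  summand m = (μ (suc m) ℤ.* + g m) / suc m ^ k

  condition : ∀ i m → Dec ((suc m ^ k ≤ a * i + r) × (g m ∣ b * i + r))
  condition i m = (suc m ^ k ≤? a * i + r) ×-dec (g m ∣? b * i + r)

  term≡when : ∀ i m → term k a b r i m ≡ when (condition i m) (summand m)
  term≡when i m with condition i m
  ... | yes _ = refl
  ... | no  _ = refl

  f≡∑term : ∀ i M → a * i + r ≤ M → f k a b r i ≡ ∑ M (term k a b r i)
  f≡∑term i M X≤M = begin
    f k a b r i                                          ≡⟨ sumℚ-upTo (term k a b r i) X ⟩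
    ∑ X (term k a b r i)                                 ≡⟨ sym (ℚₚ.+-identityʳ _) ⟩
    ∑ X (term k a b r i) ℚ.+ 0ℚ
      ≡⟨ cong (∑ X (term k a b r i) ℚ.+_) (sym (∑-zero (M ∸ X) (λ t _ → vanishes (X + t) (m≤m+n X t)))) ⟩
    ∑ X (term k a b r i) ℚ.+ ∑[ t < M ∸ X ] term k a b r i (X + t) ≡⟨ sym (∑-split X (M ∸ X) (term k a b r i)) ⟩
    ∑ (X + (M ∸ X)) (term k a b r i)                     ≡⟨ cong (λ n → ∑ n (term k a b r i)) (m+[n∸m]≡n X≤M) ⟩
    ∑ M (term k a b r i)                                 ∎
    where
    open ≡-Reasoning
    X = a * i + r
    vanishes : ∀ m → X ≤ m → term k a b r i m ≡ 0ℚ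
    vanishes m X≤m = trans (term≡when i m) (when-no (condition i m) (summand m)
      (λ (dᵏ≤X , _) → <⇒≱ (s≤s X≤m) (≤-trans (m≤m^k (suc m) k (≤-trans (s≤s z≤n) k≥2)) dᵏ≤X)))

  weight-bound : ∀ m → ℚ.∣ weight (suc m) ∣ ℚ.≤ fromℕ a ℚ.* (+ 1 / (suc m * suc m))
  weight-bound m = begin
    ℚ.∣ weight (suc m) ∣                     ≤⟨ ∣when∣≤∣∣ (γ (suc m) ∣? r) (frac z (suc m ^ k)) ⟩
    ℚ.∣ frac z (suc m ^ k) ∣                  ≡⟨ cong ℚ.∣_∣ (frac≡/ z (suc m ^ k)) ⟩
    ℚ.∣ z / suc m ^ k ∣                       ≡⟨ ∣/∣ z (suc m ^ k) ⟩
    + ℤ.∣ z ∣ / suc m ^ k                     ≤⟨ /-cross-≤ℕ ℤ.∣ z ∣ a (suc m ^ k) (suc m * suc m) cross ⟩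
    + a / (suc m * suc m)                     ≡⟨ cong (_/ (suc m * suc m)) (cong +_ (sym (*-identityʳ a))) ⟩
    + (a * 1) / (suc m * suc m)               ≡⟨ sym (fromℕ-*-/ℕ a 1 (suc m * suc m)) ⟩
    fromℕ a ℚ.* (+ 1 / (suc m * suc m))       ∎
    where
    open ℚₚ.≤-Reasoning
    z = μ (suc m) ℤ.* + γ (suc m)
    γ≤a : γ (suc m) ≤ a
    γ≤a = ∣⇒≤ (∣-trans (gcd[m,n]∣m (gcd a b) (suc m ^ k)) (gcd[m,n]∣m a b))
    ∣z∣≤a : ℤ.∣ z ∣ ≤ a
    ∣z∣≤a = subst (_≤ a) (sym (ℤₚ.abs-* (μ (suc m)) (+ γ (suc m))))
              (≤-trans (*-monoˡ-≤ (γ (suc m)) (∣μ∣≤1 (suc m))) (subst (_≤ a) (sym (*-identityˡ (γ (suc m)))) γ≤a))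
    d²≤dᵏ : suc m * suc m ≤ suc m ^ k
    d²≤dᵏ = subst (_≤ suc m ^ k) (cong (suc m *_) (*-identityʳ (suc m))) (^-monoʳ-≤ (suc m) k≥2)
    cross : ℤ.∣ z ∣ * (suc m * suc m) ≤ a * suc m ^ k
    cross = *-mono-≤ ∣z∣≤a d²≤dᵏ

  module _ (N : ℕ) where

    M : ℕ
    M = a * N + r

    hits : ℕ → ℕ
    hits m = count (λ j → condition (suc j) m) N

    S≡∑hits : S k a b r N ≡ ∑[ m < M ] (fromℕ (hits m) ℚ.* summand m)
    S≡∑hits = begin
      S k a b r N                                        ≡⟨ sumℚ-upTo (λ j → f k a b r (suc j)) N ⟩
      ∑[ j < N ] f k a b r (suc j)                       ≡⟨ ∑-cong N (λ j j<N → f≡∑term (suc j) M (+-monoˡ-≤ r (*-monoʳ-≤ a j<N))) ⟩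
      ∑[ j < N ] ∑ M (term k a b r (suc j))              ≡⟨ ∑-swap N M (λ j m → term k a b r (suc j) m) ⟩
      ∑[ m < M ] ∑[ j < N ] term k a b r (suc j) m       ≡⟨ ∑-cong M (λ m _ → trans (∑-cong N (λ j _ → term≡when (suc j) m))
                                                                                   (∑-when (λ j → condition (suc j) m) (summand m) N)) ⟩
      ∑[ m < M ] (fromℕ (hits m) ℚ.* summand m)            ∎
      where open ≡-Reasoning

    short : ℕ → ℕ
    short m = count (λ j → a * suc j + r <? suc m ^ k) N

    solutions : ℕ → ℕ
    solutions m = count (λ j → g m ∣? b * suc j + r) N

    hits≤solutions≤hits+short : ∀ m → hits m ≤ solutions m × solutions m ≤ hits m + short m
    hits≤solutions≤hits+short m = subst (hits m ≤_) (sym split) (m≤m+n (hits m) _)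
                                , subst (_≤ hits m + short m) (sym split) (+-monoʳ-≤ (hits m) short⊇)
      where
      large? = λ j → suc m ^ k ≤? a * suc j + r
      divides? = λ j → g m ∣? b * suc j + r
      split : solutions m ≡ hits m + count (λ j → ¬? (large? j) ×-dec divides? j) N
      split = count-split large? divides? N
      short⊇ : count (λ j → ¬? (large? j) ×-dec divides? j) N ≤ short m
      short⊇ = count-⊆ (λ j → ¬? (large? j) ×-dec divides? j) (λ j → a * suc j + r <? suc m ^ k) N
                 (λ j _ (small , _) → ≰⇒> small)

    -- weight d is μ(d) γᵣ / dᵏ.
    γᵣ : ∀ m → Dec (γ (suc m) ∣ r) → ℕ
    γᵣ m (yes _) = γ (suc m)
    γᵣ m (no  _) = 0

    solutions-bounds : ∀ m (γ∣r? : Dec (γ (suc m) ∣ r)) →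
                       solutions m * g m ≤ N * γᵣ m γ∣r? + g m × N * γᵣ m γ∣r? ≤ solutions m * g m + g m
    solutions-bounds m (yes γ∣r) =
      subst (λ e → solutions m * g m ≤ N * e + g m × N * e ≤ solutions m * g m + g m) (gcd[b,g]≡γ m)
        (subst (λ C → C * g m ≤ N * gcd b (g m) + g m × N * gcd b (g m) ≤ C * g m + g m) count≡
          (count-linear-bounds b (b + r) (g m) {{g≢0 m}}
            (subst (_∣ b + r) (sym (gcd[b,g]≡γ m)) (∣m∣n⇒∣m+n (γ∣b m) γ∣r)) N))
      where
      count≡ : count (λ j → g m ∣? b * j + (b + r)) N ≡ solutions m
      count≡ = count-cong (λ j → g m ∣? b * j + (b + r)) (λ j → g m ∣? b * suc j + r) N
                 (λ j _ → subst (g m ∣_) (sym (shift j)) , subst (g m ∣_) (shift j))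
    solutions-bounds m (no γ∤r) = subst (λ C → C * g m ≤ N * 0 + g m × N * 0 ≤ C * g m + g m) (sym none)
      (subst (λ x → 0 ≤ x + g m × x ≤ g m) (sym (*-zeroʳ N)) (z≤n , z≤n))
      where
      none : solutions m ≡ 0
      none = count-zero (λ j → g m ∣? b * suc j + r) N (λ j _ g∣ → γ∤r (∣m+n∣m⇒∣n
        (subst (_∣ b + r) (gcd[b,g]≡γ m) (∣linear⇒gcd∣ b (b + r) (g m) {{g≢0 m}} j (subst (g m ∣_) (shift j) g∣))) (γ∣b m)))

    hits-bounds : ∀ m (γ∣r? : Dec (γ (suc m) ∣ r)) →
                  hits m * g m ≤ N * γᵣ m γ∣r? + g m * suc (short m) × N * γᵣ m γ∣r? ≤ hits m * g m + g m * suc (short m)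
    hits-bounds m γ∣r? = upper , lower
      where
      open ≤-Reasoning
      bounds = solutions-bounds m γ∣r?
      counts = hits≤solutions≤hits+short m
      distrib : ∀ h s g → (h + s) * g + g ≡ h * g + g * suc s
      distrib = ℕ-Ring.solve-∀
      upper = begin
        hits m * g m                               ≤⟨ *-monoˡ-≤ (g m) (proj₁ counts) ⟩
        solutions m * g m                          ≤⟨ proj₁ bounds ⟩
        N * γᵣ m γ∣r? + g m                        ≤⟨ +-monoʳ-≤ (N * γᵣ m γ∣r?) (m≤m*n (g m) (suc (short m))) ⟩
        N * γᵣ m γ∣r? + g m * suc (short m)        ∎
      lower = begin
        N * γᵣ m γ∣r?                              ≤⟨ proj₂ bounds ⟩
        solutions m * g m + g m                    ≤⟨ +-monoˡ-≤ (g m) (*-monoˡ-≤ (g m) (proj₂ counts)) ⟩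
        (hits m + short m) * g m + g m             ≡⟨ distrib (hits m) (short m) (g m) ⟩
        hits m * g m + g m * suc (short m)         ∎

    error : ℕ → ℚ
    error m = fromℕ (hits m) ℚ.* summand m ℚ.- fromℕ N ℚ.* weight (suc m)

    error-bound : ∀ m → ℚ.∣ error m ∣ ℚ.≤ + (δ * suc (short m)) / suc m ^ k
    error-bound m = core (γ (suc m) ∣? r)
      where
      μd = μ (suc m)
      D = suc m ^ k
      core : (γ∣r? : Dec (γ (suc m) ∣ r)) →
             ℚ.∣ fromℕ (hits m) ℚ.* summand m ℚ.- fromℕ N ℚ.* when γ∣r? (frac (μd ℤ.* + γ (suc m)) D) ∣ ℚ.≤
             + (δ * suc (short m)) / D
      core γ∣r? = begin
        ℚ.∣ fromℕ (hits m) ℚ.* summand m ℚ.- fromℕ N ℚ.* when γ∣r? (frac (μd ℤ.* + γ (suc m)) D) ∣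
          ≡⟨ cong (λ w → ℚ.∣ fromℕ (hits m) ℚ.* summand m ℚ.- fromℕ N ℚ.* w ∣) (weight-fraction γ∣r?) ⟩
        ℚ.∣ fromℕ (hits m) ℚ.* summand m ℚ.- fromℕ N ℚ.* ((μd ℤ.* + γᵣ m γ∣r?) / D) ∣
          ≡⟨ cong ℚ.∣_∣ (cong₂ ℚ._-_ (fromℕ-*-/ (hits m) (μd ℤ.* + g m) D) (fromℕ-*-/ N (μd ℤ.* + γᵣ m γ∣r?) D)) ⟩
        ℚ.∣ (+ hits m ℤ.* (μd ℤ.* + g m)) / D ℚ.- (+ N ℤ.* (μd ℤ.* + γᵣ m γ∣r?)) / D ∣
          ≡⟨ cong ℚ.∣_∣ (/-sub (+ hits m ℤ.* (μd ℤ.* + g m)) (+ N ℤ.* (μd ℤ.* + γᵣ m γ∣r?)) D) ⟩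
        ℚ.∣ (+ hits m ℤ.* (μd ℤ.* + g m) ℤ.- + N ℤ.* (μd ℤ.* + γᵣ m γ∣r?)) / D ∣
          ≡⟨ cong (λ z → ℚ.∣ z / D ∣) factor-μ ⟩
        ℚ.∣ (μd ℤ.* X) / D ∣                       ≡⟨ ∣/∣ (μd ℤ.* X) D ⟩
        + ℤ.∣ μd ℤ.* X ∣ / D                        ≤⟨ /-mono-≤ D ∣μX∣≤ ⟩
        + (δ * suc (short m)) / D                   ∎
        where
        open ℚₚ.≤-Reasoning
        X = + (hits m * g m) ℤ.- + (N * γᵣ m γ∣r?)
        weight-fraction : ∀ γ∣r? → when γ∣r? (frac (μd ℤ.* + γ (suc m)) D) ≡ (μd ℤ.* + γᵣ m γ∣r?) / D
        weight-fraction (yes _) = frac≡/ (μd ℤ.* + γ (suc m)) D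
        weight-fraction (no _)  = sym (trans (cong (_/ D) (ℤₚ.*-zeroʳ μd)) (ℚₚ.0/n≡0 D))
        distrib : ∀ c μ g n h → c ℤ.* (μ ℤ.* g) ℤ.- n ℤ.* (μ ℤ.* h) ≡ μ ℤ.* (c ℤ.* g ℤ.- n ℤ.* h)
        distrib = ℤ-Ring.solve-∀
        factor-μ : + hits m ℤ.* (μd ℤ.* + g m) ℤ.- + N ℤ.* (μd ℤ.* + γᵣ m γ∣r?) ≡ μd ℤ.* X
        factor-μ = trans (distrib (+ hits m) μd (+ g m) (+ N) (+ γᵣ m γ∣r?))
                         (cong (μd ℤ.*_) (sym (cong₂ ℤ._-_ (ℤₚ.pos-* (hits m) (g m)) (ℤₚ.pos-* N (γᵣ m γ∣r?)))))
        ∣X∣≤ : ℤ.∣ X ∣ ≤ g m * suc (short m)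
        ∣X∣≤ = ∣+m-+n∣≤ (hits m * g m) (N * γᵣ m γ∣r?) (g m * suc (short m))
                 (proj₁ (hits-bounds m γ∣r?)) (proj₂ (hits-bounds m γ∣r?))
        ∣μX∣≤ : ℤ.∣ μd ℤ.* X ∣ ≤ δ * suc (short m)
        ∣μX∣≤ = subst₂ _≤_ (sym (ℤₚ.abs-* μd X)) (*-identityˡ (δ * suc (short m)))
                  (*-mono-≤ (∣μ∣≤1 (suc m)) (≤-trans ∣X∣≤ (*-monoˡ-≤ (suc (short m)) g≤δ)))
          where
          g≤δ : g m ≤ δ
          g≤δ = ∣⇒≤ (gcd[m,n]∣m δ (suc m ^ k))

    module _ (N≥1 : 1 ≤ N) where

      private instance
        M≢0 : NonZero M
        M≢0 = >-nonZero (≤-trans (*-mono-≤ a≥1 N≥1) (m≤m+n (a * N) r))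

      Y : ℕ
      Y = iroot k N

      Y≥1 : 1 ≤ Y
      Y≥1 = iroot≥1 k N N≥1

      errorBound : ℕ → ℚ
      errorBound m = + (δ * suc (short m)) / suc m ^ k

      errorBound-small : ∀ m → errorBound m ℚ.≤ fromℕ (δ * 2)
      errorBound-small m = /-cross-≤ℕ (δ * suc (short m)) (δ * 2) (suc m ^ k) 1
        (subst₂ _≤_ (sym (*-identityʳ (δ * suc (short m)))) (sym (*-assoc δ 2 (suc m ^ k)))
          (*-monoʳ-≤ δ (subst (suc (short m) ≤_) (cong (_+_ (suc m ^ k)) (sym (+-identityʳ (suc m ^ k))))
            (+-mono-≤ (≤-trans (s≤s z≤n) (m≤m^k (suc m) k (≤-trans (s≤s z≤n) k≥2))) short≤dᵏ))))
        where
        short≤dᵏ : short m ≤ suc m ^ k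
        short≤dᵏ = count-bounded (λ j → a * suc j + r <? suc m ^ k) N (suc m ^ k)
          (λ j _ small → ≤-<-trans (≤-trans (n≤1+n j) (≤-trans (m≤n*m (suc j) a) (m≤m+n (a * suc j) r))) small)

      errorBound-large : ∀ i → errorBound (Y + i) ℚ.≤ fromℕ (δ * (suc Y * suc Y)) ℚ.* (+ 1 / (suc (Y + i) * suc (Y + i)))
      errorBound-large i = ℚₚ.≤-trans (/-cross-≤ℕ (δ * suc (short (Y + i))) (δ * (suc Y * suc Y)) (d ^ k) (d * d) cross)
                                      (ℚₚ.≤-reflexive (sym (trans (fromℕ-*-/ℕ (δ * (suc Y * suc Y)) 1 (d * d))
                                                                  (cong (λ x → + x / (d * d)) (*-identityʳ (δ * (suc Y * suc Y)))))))
        where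
        d = suc (Y + i)
        k′ = k ∸ 2
        xᵏ≡ : ∀ x → x ^ k ≡ x * (x * x ^ k′)
        xᵏ≡ x = cong (x ^_) (sym (m+[n∸m]≡n k≥2))
        regroup : ∀ s t d → s * (s * t) * (d * d) ≡ s * s * (d * (d * t))
        regroup = ℕ-Ring.solve-∀
        [Y+1]ᵏd²≤[Y+1]²dᵏ : suc Y ^ k * (d * d) ≤ suc Y * suc Y * d ^ k
        [Y+1]ᵏd²≤[Y+1]²dᵏ = begin
          suc Y ^ k * (d * d)                       ≡⟨ cong (_* (d * d)) (xᵏ≡ (suc Y)) ⟩
          suc Y * (suc Y * suc Y ^ k′) * (d * d)    ≡⟨ regroup (suc Y) (suc Y ^ k′) d ⟩
          suc Y * suc Y * (d * (d * suc Y ^ k′))    ≤⟨ *-monoʳ-≤ (suc Y * suc Y) (*-monoʳ-≤ d (*-monoʳ-≤ d (^-monoˡ-≤ k′ (s≤s (m≤m+n Y i))))) ⟩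
          suc Y * suc Y * (d * (d * d ^ k′))        ≡⟨ cong (suc Y * suc Y *_) (sym (xᵏ≡ d)) ⟩
          suc Y * suc Y * d ^ k                     ∎
          where open ≤-Reasoning
        1+short≤[Y+1]ᵏ : suc (short (Y + i)) ≤ suc Y ^ k
        1+short≤[Y+1]ᵏ = ≤-trans (s≤s (count-≤ (λ j → a * suc j + r <? d ^ k) N)) (proj₂ (iroot-spec k N))
        cross : δ * suc (short (Y + i)) * (d * d) ≤ δ * (suc Y * suc Y) * d ^ k
        cross = subst₂ _≤_ (sym (*-assoc δ _ (d * d))) (sym (*-assoc δ _ (d ^ k)))
                  (*-monoʳ-≤ δ (≤-trans (*-monoˡ-≤ (d * d) 1+short≤[Y+1]ᵏ) [Y+1]ᵏd²≤[Y+1]²dᵏ))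

      ∑errorBound≤ : ∑ M errorBound ℚ.≤ fromℕ (Y * (δ * 2) + δ * (2 * suc Y))
      ∑errorBound≤ = begin
        ∑ M errorBound                                             ≡⟨ cong (λ n → ∑ n errorBound) (sym (m+[n∸m]≡n Y≤M)) ⟩
        ∑ (Y + L) errorBound                                       ≡⟨ ∑-split Y L errorBound ⟩
        ∑ Y errorBound ℚ.+ ∑[ i < L ] errorBound (Y + i)           ≤⟨ ℚₚ.+-mono-≤ small large ⟩
        fromℕ (Y * (δ * 2)) ℚ.+ fromℕ (δ * (2 * suc Y))            ≡⟨ sym (fromℕ-+ (Y * (δ * 2)) (δ * (2 * suc Y))) ⟩
        fromℕ (Y * (δ * 2) + δ * (2 * suc Y))                      ∎
        where
        open ℚₚ.≤-Reasoning
        Y≤M : Y ≤ M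
        Y≤M = ≤-trans (m≤m^k Y k {{>-nonZero Y≥1}} (≤-trans (s≤s z≤n) k≥2))
                (≤-trans (proj₁ (iroot-spec k N)) (≤-trans (m≤n*m N a) (m≤m+n (a * N) r)))
        L = M ∸ Y
        c = δ * (suc Y * suc Y)
        small : ∑ Y errorBound ℚ.≤ fromℕ (Y * (δ * 2))
        small = ℚₚ.≤-trans (∑-mono-≤ Y (λ m _ → errorBound-small m))
                           (ℚₚ.≤-reflexive (trans (∑-const Y (fromℕ (δ * 2))) (sym (fromℕ-* Y (δ * 2)))))
        regroup : ∀ δ s → δ * (s * s) * 2 * 1 ≡ δ * (2 * s) * s
        regroup = ℕ-Ring.solve-∀
        large : ∑[ i < L ] errorBound (Y + i) ℚ.≤ fromℕ (δ * (2 * suc Y))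
        large = begin
          ∑[ i < L ] errorBound (Y + i)                                  ≤⟨ ∑-mono-≤ L (λ i _ → errorBound-large i) ⟩
          ∑[ i < L ] (fromℕ c ℚ.* (+ 1 / (suc (Y + i) * suc (Y + i))))   ≡⟨ ∑-*ˡ L (fromℕ c) (λ i → + 1 / (suc (Y + i) * suc (Y + i))) ⟩
          fromℕ c ℚ.* ∑[ i < L ] (+ 1 / (suc (Y + i) * suc (Y + i)))     ≤⟨ ℚₚ.*-monoˡ-≤-nonNeg (fromℕ c) {{fromℕ-nonNeg c}} (∑-inverse-squares Y L) ⟩
          fromℕ c ℚ.* (+ 2 / suc Y)                                      ≡⟨ fromℕ-*-/ℕ c 2 (suc Y) ⟩
          + (c * 2) / suc Y                                              ≤⟨ /-cross-≤ℕ (c * 2) (δ * (2 * suc Y)) (suc Y) 1 (≤-reflexive (regroup δ (suc Y))) ⟩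
          fromℕ (δ * (2 * suc Y))                                        ∎

      bound≤KY : Y * (δ * 2) + δ * (2 * suc Y) + 2 ≤ K * Y
      bound≤KY = go Y Y≥1
        where
        expand : ∀ δ y → (6 * δ + 2) * suc y ≡ suc y * (δ * 2) + δ * (2 * suc (suc y)) + 2 + (2 * δ * y + 2 * y)
        expand = ℕ-Ring.solve-∀
        go : ∀ y → 1 ≤ y → y * (δ * 2) + δ * (2 * suc y) + 2 ≤ K * y
        go (suc y) _ = subst (suc y * (δ * 2) + δ * (2 * suc (suc y)) + 2 ≤_) (sym (expand δ y)) (m≤m+n _ (2 * δ * y + 2 * y))

      module _ (P : ℕ) (M≤P : M ≤ P) where

        Q : ℕ
        Q = primorial P

        L : ℕ
        L = Q * M ∸ M

        tail : ℚ
        tail = ∑[ i < L ] when (suc (M + i) ∣? Q) (weight (suc (M + i)))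

        θpartial≡∑weight+tail : θpartial k a b r P ≡ ∑[ m < M ] weight (suc m) ℚ.+ tail
        θpartial≡∑weight+tail = begin
          θpartial k a b r P                  ≡⟨ sym (euler-product P M) ⟩
          divisorSum Q (Q * M)                ≡⟨ cong (divisorSum Q) (sym (m+[n∸m]≡n (m≤n*m M Q {{primorial≢0 P}}))) ⟩
          divisorSum Q (M + L)                ≡⟨ ∑-split M L (λ m → when (suc m ∣? Q) (weight (suc m))) ⟩
          divisorSum Q M ℚ.+ tail             ≡⟨ cong (ℚ._+ tail) (∑-cong M divisor) ⟩
          ∑[ m < M ] weight (suc m) ℚ.+ tail  ∎
          where
          open ≡-Reasoning
          divisor : ∀ m → m < M → when (suc m ∣? Q) (weight (suc m)) ≡ weight (suc m)
          divisor m m<M with suc m ∣? Q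
          ... | yes _   = refl
          ... | no  d∤Q = sym (weight-vanishes P m (≤-trans m<M M≤P) d∤Q)

        N*∣tail∣≤2 : fromℕ N ℚ.* ℚ.∣ tail ∣ ℚ.≤ fromℕ 2
        N*∣tail∣≤2 = begin
          fromℕ N ℚ.* ℚ.∣ tail ∣                          ≤⟨ ℚₚ.*-monoˡ-≤-nonNeg (fromℕ N) {{fromℕ-nonNeg N}} ∣tail∣≤ ⟩
          fromℕ N ℚ.* (fromℕ a ℚ.* (+ 2 / suc M))          ≡⟨ cong (fromℕ N ℚ.*_) (fromℕ-*-/ℕ a 2 (suc M)) ⟩
          fromℕ N ℚ.* (+ (a * 2) / suc M)                 ≡⟨ fromℕ-*-/ℕ N (a * 2) (suc M) ⟩
          + (N * (a * 2)) / suc M                         ≤⟨ /-cross-≤ℕ (N * (a * 2)) 2 (suc M) 1 cross ⟩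
          fromℕ 2                                         ∎
          where
          open ℚₚ.≤-Reasoning
          F : ℕ → ℚ
          F i = when (suc (M + i) ∣? Q) (weight (suc (M + i)))
          ∣tail∣≤ : ℚ.∣ tail ∣ ℚ.≤ fromℕ a ℚ.* (+ 2 / suc M)
          ∣tail∣≤ = begin
            ℚ.∣ tail ∣                                                  ≤⟨ ∣∑∣≤∑∣∣ L F ⟩
            ∑[ i < L ] ℚ.∣ F i ∣                                         ≤⟨ ∑-mono-≤ L (λ i _ → ℚₚ.≤-trans (∣when∣≤∣∣ (suc (M + i) ∣? Q) _) (weight-bound (M + i))) ⟩
            ∑[ i < L ] (fromℕ a ℚ.* (+ 1 / (suc (M + i) * suc (M + i)))) ≡⟨ ∑-*ˡ L (fromℕ a) (λ i → + 1 / (suc (M + i) * suc (M + i))) ⟩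
            fromℕ a ℚ.* ∑[ i < L ] (+ 1 / (suc (M + i) * suc (M + i)))  ≤⟨ ℚₚ.*-monoˡ-≤-nonNeg (fromℕ a) {{fromℕ-nonNeg a}} (∑-inverse-squares M L) ⟩
            fromℕ a ℚ.* (+ 2 / suc M)                                   ∎
          rearrange : ∀ N a → N * (a * 2) * 1 ≡ 2 * (a * N)
          rearrange = ℕ-Ring.solve-∀
          cross : N * (a * 2) * 1 ≤ 2 * suc M
          cross = subst (_≤ 2 * suc M) (sym (rearrange N a)) (*-monoʳ-≤ 2 (m≤n⇒m≤1+n (m≤m+n (a * N) r)))

        S-θN≡∑error-tail : S k a b r N ℚ.- θpartial k a b r P ℚ.* fromℕ N ≡ ∑ M error ℚ.- tail ℚ.* fromℕ N
        S-θN≡∑error-tail = begin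
          S k a b r N ℚ.- θpartial k a b r P ℚ.* fromℕ N
            ≡⟨ cong₂ (λ s t → s ℚ.- t ℚ.* fromℕ N) S≡∑hits θpartial≡∑weight+tail ⟩
          ∑ M hitsTerm ℚ.- (∑ M W ℚ.+ tail) ℚ.* fromℕ N
            ≡⟨ regroup (∑ M hitsTerm) (∑ M W) tail (fromℕ N) ⟩
          (∑ M hitsTerm ℚ.- fromℕ N ℚ.* ∑ M W) ℚ.- tail ℚ.* fromℕ N
            ≡⟨ cong (λ x → (∑ M hitsTerm ℚ.- x) ℚ.- tail ℚ.* fromℕ N) (sym (∑-*ˡ M (fromℕ N) W)) ⟩
          (∑ M hitsTerm ℚ.- ∑[ m < M ] (fromℕ N ℚ.* W m)) ℚ.- tail ℚ.* fromℕ N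
            ≡⟨ cong (ℚ._- tail ℚ.* fromℕ N) (sym (∑-sub M hitsTerm (λ m → fromℕ N ℚ.* W m))) ⟩
          ∑ M error ℚ.- tail ℚ.* fromℕ N ∎
          where
          open ≡-Reasoning
          hitsTerm W : ℕ → ℚ
          hitsTerm m = fromℕ (hits m) ℚ.* summand m
          W m = weight (suc m)
          regroup : ∀ s w t n → s ℚ.- (w ℚ.+ t) ℚ.* n ≡ (s ℚ.- n ℚ.* w) ℚ.- t ℚ.* n
          regroup = solve 4 (λ s w t n → s :- (w :+ t) :* n := (s :- n :* w) :- t :* n) refl
            where open ℚ-Solver.+-*-Solver

        ∣S-θN∣≤KY : ℚ.∣ S k a b r N ℚ.- θpartial k a b r P ℚ.* fromℕ N ∣ ℚ.≤ fromℕ (K * Y)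
        ∣S-θN∣≤KY = begin
          ℚ.∣ S k a b r N ℚ.- θpartial k a b r P ℚ.* fromℕ N ∣   ≡⟨ cong ℚ.∣_∣ S-θN≡∑error-tail ⟩
          ℚ.∣ ∑ M error ℚ.- tail ℚ.* fromℕ N ∣                  ≤⟨ ℚₚ.∣p-q∣≤∣p∣+∣q∣ (∑ M error) (tail ℚ.* fromℕ N) ⟩
          ℚ.∣ ∑ M error ∣ ℚ.+ ℚ.∣ tail ℚ.* fromℕ N ∣             ≡⟨ cong (ℚ.∣ ∑ M error ∣ ℚ.+_) ∣tail*N∣≡ ⟩
          ℚ.∣ ∑ M error ∣ ℚ.+ fromℕ N ℚ.* ℚ.∣ tail ∣             ≤⟨ ℚₚ.+-mono-≤ ∣∑error∣≤ N*∣tail∣≤2 ⟩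
          fromℕ (Y * (δ * 2) + δ * (2 * suc Y)) ℚ.+ fromℕ 2      ≡⟨ sym (fromℕ-+ (Y * (δ * 2) + δ * (2 * suc Y)) 2) ⟩
          fromℕ (Y * (δ * 2) + δ * (2 * suc Y) + 2)              ≤⟨ fromℕ-mono-≤ bound≤KY ⟩
          fromℕ (K * Y)                                          ∎
          where
          open ℚₚ.≤-Reasoning
          ∣tail*N∣≡ : ℚ.∣ tail ℚ.* fromℕ N ∣ ≡ fromℕ N ℚ.* ℚ.∣ tail ∣
          ∣tail*N∣≡ = trans (ℚₚ.∣p*q∣≡∣p∣*∣q∣ tail (fromℕ N))
                     (trans (cong (ℚ.∣ tail ∣ ℚ.*_) (ℚₚ.0≤p⇒∣p∣≡p (ℚₚ.nonNegative⁻¹ (fromℕ N) {{fromℕ-nonNeg N}})))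
                            (ℚₚ.*-comm ℚ.∣ tail ∣ (fromℕ N)))
          ∣∑error∣≤ : ℚ.∣ ∑ M error ∣ ℚ.≤ fromℕ (Y * (δ * 2) + δ * (2 * suc Y))
          ∣∑error∣≤ = ℚₚ.≤-trans (∣∑∣≤∑∣∣ M error) (ℚₚ.≤-trans (∑-mono-≤ M (λ m _ → error-bound m)) ∑errorBound≤)

        ∣S-θN∣ᵏ≤ : ∀ ε → Positive ε →
                   ℚ.∣ S k a b r N ℚ.- θpartial k a b r P ℚ.* fromℕ N ∣ ^ℚ k ℚ.≤ fromℕ (K ^ k * N) ℚ.+ ε
        ∣S-θN∣ᵏ≤ ε ε>0 = begin
          ℚ.∣ S k a b r N ℚ.- θpartial k a b r P ℚ.* fromℕ N ∣ ^ℚ k ≤⟨ ^ℚ-mono-≤ k (ℚₚ.0≤∣p∣ _) ∣S-θN∣≤KY ⟩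
          fromℕ (K * Y) ^ℚ k                  ≡⟨ sym (fromℕ-^ (K * Y) k) ⟩
          fromℕ ((K * Y) ^ k)                 ≡⟨ cong fromℕ (^-distribʳ-* K Y k) ⟩
          fromℕ (K ^ k * Y ^ k)               ≤⟨ fromℕ-mono-≤ (*-monoʳ-≤ (K ^ k) (proj₁ (iroot-spec k N))) ⟩
          fromℕ (K ^ k * N)                   ≡⟨ sym (ℚₚ.+-identityʳ _) ⟩
          fromℕ (K ^ k * N) ℚ.+ 0ℚ            ≤⟨ ℚₚ.+-monoʳ-≤ (fromℕ (K ^ k * N)) (ℚₚ.<⇒≤ (ℚₚ.positive⁻¹ ε {{ε>0}})) ⟩
          fromℕ (K ^ k * N) ℚ.+ ε             ∎
          where open ℚₚ.≤-Reasoning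

-- The argument does not use the hypothesis b ≥ 1.
lemma3p1 : (k a b r : ℕ) → k ≥ 2 → a ≥ 1 → b ≥ 1 → a ≢ b →
    ∃ λ (C : ℕ) → (N : ℕ) → N ≥ 1 → (ε : ℚ) → Positive ε →
      ∃ λ (P₀ : ℕ) → (P : ℕ) → P ≥ P₀ →
        (ℚ.∣ S k a b r N ℚ.- θpartial k a b r P ℚ.* (+ N / 1) ∣ ^ℚ k) ℚ.≤ (+ (C * N) / 1) ℚ.+ ε
lemma3p1 k a b r k≥2 a≥1 _ a≢b =
  K ^ k , λ N N≥1 ε ε>0 → M N , λ P M≤P → ∣S-θN∣ᵏ≤ N N≥1 P M≤P ε ε>0
  where open Estimate k a b r k≥2 a≥1 a≢b
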